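{- Let $(G,<,+,0,\ldots)$ be an o-minimal expansion of an ordered abelian group, let $X\subseteq G^{m+n}$ be a definable set, let $\mathcal{D}$ be a cell decomposition of $G^{m+n}$ partitioning $X$ (i.e. $X$ is a union of cells of $\mathcal{D}$) such that no cell of $\mathcal{D}$ is exceptional, and let $\pi:G^{m+n}\to G^m$ be the projection onto the first $m$ coordinates. Then for each cell $A\in\pi(\mathcal{D})=\{\pi(C)\mid C\in\mathcal{D}\}$ there is an integer $e_A$ such that $\chi_b(X_a)=e_A$ for every $a\in A$, where $X_a=\{y\in G^n\mid (a,y)\in X\}$, and moreover $\chi_b(X\cap\pi^{ -1}(A))=\chi_b(A)\,e_A$.
   Context: Cells are the cells of o-minimal cell decomposition. For $k\le N$ let $p_k:G^N\to G^k$ be the projection onto the first $k$ coordinates. A cell $C\subseteq G^N$ is exceptional if there exist $k$ and a cell $A\subseteq G^{k-1}$ with $p_k(C)=A\times G$. A non-exceptional cell $C$ is bad if there exist $k$, a cell $A\subseteq G^{k-1}$ and a definable $f:A\to G$ with $p_k(C)=\{(x,t)\in A\times G\mid t<f(x)\}$ or $p_k(C)=\{(x,t)\in A\times G\mid f(x)<t\}$. A cell is good if it is neither exceptional nor bad. For a definable set $Y\subseteq G^N$, $\chi_b(Y):=\sum_{C\in\mathcal{F},\,C\text{ good}}(-1)^{\dim C}$, where $\mathcal{F}$ is any finite partition of $Y$ into non-exceptional cells (such partitions exist and the value does not depend on the choice). -}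

module Defs where

open import Level using (0ℓ)
open import Data.Nat using (ℕ; zero; suc; _+_)
open import Data.Integer using (ℤ; 0ℤ; 1ℤ; -_) renaming (_+_ to _+ℤ_)
open import Data.Fin using (Fin) renaming (zero to fz; suc to fs)
open import Data.Vec using (Vec; []; _∷_; lookup; init; last; take; tail; _∷ʳ_)
open import Data.List using (List; []; _∷_; length; map; foldr)
import Data.List as L
open import Data.List.Relation.Unary.Any using (Any)
open import Data.List.Relation.Unary.All using (All)
open import Data.List.Membership.Propositional using (_∈_)
open import Data.Maybe using (Maybe; just; nothing)
open import Data.Product using (Σ; ∃; _×_; _,_; proj₁; proj₂)
open import Data.Sum using (_⊎_)
open import Data.Unit using (⊤)
open import Data.Empty using (⊥)
open import Relation.Nullary using (¬_; Dec; yes; no)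
open import Relation.Binary using (Rel)
open import Relation.Binary.Structures using (IsStrictTotalOrder)
open import Relation.Binary.PropositionalEquality using (_≡_; _≢_; subst; sym)
open import Algebra.Core using (Op₁; Op₂)
open import Algebra.Structures using (IsAbelianGroup)

_≐_ : ∀ {A : Set} → (A → Set) → (A → Set) → Set
P ≐ Q = ∀ v → (P v → Q v) × (Q v → P v)

_⊆_ : ∀ {A : Set} → (A → Set) → (A → Set) → Set
P ⊆ Q = ∀ v → P v → Q v

sign : ℕ → ℤ
sign zero = 1ℤ
sign (suc d) = - sign d

-- Pieces of a definable subset of G (o-minimality): points and open
-- intervals (l,u); nothing = -∞ (as lower end) resp. +∞ (as upper end).

data Piece (G : Set) : Set where
  point    : G → Piece G
  interval : Maybe G → Maybe G → Piece G

lowerOK : {G : Set} → Rel G 0ℓ → Maybe G → G → Set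
lowerOK _<_ nothing  t = ⊤
lowerOK _<_ (just a) t = a < t

upperOK : {G : Set} → Rel G 0ℓ → Maybe G → G → Set
upperOK _<_ nothing  t = ⊤
upperOK _<_ (just b) t = t < b

inPiece : {G : Set} → Rel G 0ℓ → Piece G → G → Set
inPiece _<_ (point a)      t = t ≡ a
inPiece _<_ (interval l u) t = lowerOK _<_ l t × upperOK _<_ u t

-- Definable sets are given as a "structure" in the sense of van den
-- Dries: for each n a collection Def n of subsets of G^n (points of G^n
-- are Vec G n), containing the basic relations (order, graph of +,
-- equality of coordinates, singletons = parameters), closed under
-- boolean operations, cartesian products with G and coordinate
-- projection; o-minimality: every definable subset of G is a finite
-- union of points and open intervals with endpoints in G ∪ {±∞}.
-- The order is dense without endpoints (van den Dries' standing
-- assumption for cell decompositions).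

record OMinExpansion : Set₁ where
  field
    G     : Set
    _<_   : Rel G 0ℓ
    _⊕_   : Op₂ G
    0#    : G
    ⊖_    : Op₁ G
    isStrictTotalOrder : IsStrictTotalOrder _≡_ _<_
    isAbelianGroup     : IsAbelianGroup _≡_ _⊕_ 0# ⊖_
    +-mono-<  : ∀ {x y} z → x < y → (x ⊕ z) < (y ⊕ z)
    dense     : ∀ {x y} → x < y → ∃ λ z → (x < z) × (z < y)
    no-max    : ∀ x → ∃ λ y → x < y
    no-min    : ∀ x → ∃ λ y → y < x
    Def       : (n : ℕ) → (Vec G n → Set) → Set
    Def-ext   : ∀ {n} {P Q : Vec G n → Set} → P ≐ Q → Def n P → Def n Q
    Def-∅     : ∀ n → Def n (λ _ → ⊥)
    Def-∩     : ∀ {n} {P Q : Vec G n → Set} → Def n P → Def n Q → Def n (λ v → P v × Q v)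
    Def-∪     : ∀ {n} {P Q : Vec G n → Set} → Def n P → Def n Q → Def n (λ v → P v ⊎ Q v)
    Def-∁     : ∀ {n} {P : Vec G n → Set} → Def n P → Def n (λ v → ¬ P v)
    Def-×G    : ∀ {n} {P : Vec G n → Set} → Def n P → Def (suc n) (λ v → P (init v))
    Def-G×    : ∀ {n} {P : Vec G n → Set} → Def n P → Def (suc n) (λ v → P (tail v))
    Def-eq    : ∀ n (i j : Fin n) → Def n (λ v → lookup v i ≡ lookup v j)
    Def-proj  : ∀ {n} {P : Vec G (suc n) → Set} → Def (suc n) P → Def n (λ x → ∃ λ t → P (x ∷ʳ t))
    Def-<     : Def 2 (λ v → lookup v fz < lookup v (fs fz))
    Def-+     : Def 3 (λ v → (lookup v fz ⊕ lookup v (fs fz)) ≡ lookup v (fs (fs fz)))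
    Def-const : ∀ (a : G) → Def 1 (λ v → lookup v fz ≡ a)
    o-minimal : ∀ (P : Vec G 1 → Set) → Def 1 P →
                ∃ λ (ps : List (Piece G)) →
                  P ≐ (λ v → Any (λ p → inPiece _<_ p (lookup v fz)) ps)

module _ (𝓜 : OMinExpansion) where
  open OMinExpansion 𝓜

  -- f : A → G is definable: its graph over A is definable.
  -- (f is given as a total function on G^n; only its values on A matter.)
  DefFunOn : ∀ {n} → (Vec G n → Set) → (Vec G n → G) → Set
  DefFunOn {n} A f = Def (suc n) (λ v → A (init v) × last v ≡ f (init v))

  InBox : ∀ {n} → Vec G n → Vec G n → Vec G n → Set
  InBox lo hi x = ∀ i → (lookup lo i < lookup x i) × (lookup x i < lookup hi i)

  ContOn : ∀ {n} → (Vec G n → Set) → (Vec G n → G) → Set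
  ContOn {n} A f = ∀ x → A x → ∀ a b → a < f x → f x < b →
                   ∃ λ (lo : Vec G n) → ∃ λ (hi : Vec G n) → InBox lo hi x ×
                     (∀ y → A y → InBox lo hi y → (a < f y) × (f y < b))

  -- boundary functions of a band: nothing = -∞ / +∞
  Bound : ℕ → Set
  Bound n = Maybe (Vec G n → G)

  BoundOK : ∀ {n} → (Vec G n → Set) → Bound n → Set
  BoundOK A nothing  = ⊤
  BoundOK A (just f) = DefFunOn A f × ContOn A f

  Below : ∀ {n} → (Vec G n → Set) → Bound n → Bound n → Set
  Below A (just f) (just g) = ∀ x → A x → f x < g x
  Below A _ _ = ⊤

  aboveL : ∀ {n} → Bound n → Vec G n → G → Set
  aboveL nothing  x t = ⊤
  aboveL (just f) x t = f x < t

  belowU : ∀ {n} → Bound n → Vec G n → G → Set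
  belowU nothing  x t = ⊤
  belowU (just g) x t = t < g x

  mutual
    data Cell : ℕ → Set where
      pt    : Cell 0
      graph : ∀ {n} (A : Cell n) (f : Vec G n → G) →
              DefFunOn ⟦ A ⟧ f → ContOn ⟦ A ⟧ f → Cell (suc n)
      band  : ∀ {n} (A : Cell n) (l u : Bound n) →
              BoundOK ⟦ A ⟧ l → BoundOK ⟦ A ⟧ u → Below ⟦ A ⟧ l u → Cell (suc n)

    ⟦_⟧ : ∀ {n} → Cell n → Vec G n → Set
    ⟦ pt ⟧ v = ⊤
    ⟦ graph A f _ _ ⟧ v = ⟦ A ⟧ (init v) × (last v ≡ f (init v))
    ⟦ band A l u _ _ _ ⟧ v = ⟦ A ⟧ (init v) × aboveL l (init v) (last v) × belowU u (init v) (last v)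

  dim : ∀ {n} → Cell n → ℕ
  dim pt = 0
  dim (graph A _ _ _) = dim A
  dim (band A _ _ _ _ _) = suc (dim A)

  proj : ∀ (k : ℕ) {r} → (Vec G (k + r) → Set) → Vec G k → Set
  proj k {r} S y = ∃ λ v → S v × take k {r} v ≡ y

  pSet : ∀ {N} (k r : ℕ) → suc k + r ≡ N → (Vec G N → Set) → Vec G (suc k) → Set
  pSet {N} k r eq S = proj (suc k) {r} (subst (λ m → Vec G m → Set) (sym eq) S)

  Exceptional : ∀ {N} → Cell N → Set
  Exceptional {N} C =
    ∃ λ k → ∃ λ r → Σ (suc k + r ≡ N) λ eq → ∃ λ (A : Cell k) →
      pSet k r eq ⟦ C ⟧ ≐ (λ v → ⟦ A ⟧ (init v))

  Bad : ∀ {N} → Cell N → Set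
  Bad {N} C = ¬ Exceptional C ×
    (∃ λ k → ∃ λ r → Σ (suc k + r ≡ N) λ eq → ∃ λ (A : Cell k) →
      ∃ λ (f : Vec G k → G) → DefFunOn ⟦ A ⟧ f ×
        ((pSet k r eq ⟦ C ⟧ ≐ (λ v → ⟦ A ⟧ (init v) × (last v < f (init v))))
         ⊎ (pSet k r eq ⟦ C ⟧ ≐ (λ v → ⟦ A ⟧ (init v) × (f (init v) < last v)))))

  Good : ∀ {N} → Cell N → Set
  Good C = ¬ Exceptional C × ¬ Bad C

  IsPartition : ∀ {N} → List (Cell N) → (Vec G N → Set) → Set
  IsPartition F Y =
    (∀ v → Y v → ∃ λ i → ⟦ L.lookup F i ⟧ v) ×
    (∀ i → ⟦ L.lookup F i ⟧ ⊆ Y) ×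
    (∀ i j → i ≢ j → ∀ v → ⟦ L.lookup F i ⟧ v → ⟦ L.lookup F j ⟧ v → ⊥)

  IsDecomp : (N : ℕ) → List (Cell N) → Set
  IsDecomp zero D = IsPartition D (λ _ → ⊤)
  IsDecomp (suc N) D = IsPartition D (λ _ → ⊤) ×
    ∃ λ (E : List (Cell N)) → IsDecomp N E ×
      (∀ C → C ∈ D → ∃ λ A → A ∈ E × (⟦ A ⟧ ≐ (λ x → ∃ λ t → ⟦ C ⟧ (x ∷ʳ t)))) ×
      (∀ A → A ∈ E → ∃ λ C → C ∈ D × (⟦ A ⟧ ≐ (λ x → ∃ λ t → ⟦ C ⟧ (x ∷ʳ t))))

  contrib : ∀ {N} → Σ (Cell N) (λ C → Dec (Good C)) → ℤ
  contrib (C , yes _) = sign (dim C)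
  contrib (C , no _)  = 0ℤ

  -- χ_b(Y) = z : some finite partition F of Y into non-exceptional cells
  -- gives  Σ_{C ∈ F good} (-1)^dim C = z.  (The context asserts such
  -- partitions exist and that the value is independent of F.)
  ChiB : ∀ {N} → (Vec G N → Set) → ℤ → Set
  ChiB {N} Y z = ∃ λ (F : List (Σ (Cell N) (λ C → Dec (Good C)))) →
    IsPartition (map proj₁ F) Y ×
    All (λ c → ¬ Exceptional (proj₁ c)) F ×
    z ≡ foldr (λ c s → contrib c +ℤ s) 0ℤ F

{-# OPTIONS --safe #-}
module Submission where

-- Write each cell as a stack of layers (graph, bounded band, half-bounded band, unbounded band).
-- A cell is exceptional iff one of its layers is unbounded, and bad iff it is not exceptional and
-- one of its layers is half-bounded; so a non-exceptional cell contributes to χ_b the product of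
-- the weights 1, -1, 0 of its layers. The cells of the decomposition that lie in X above A
-- partition X ∩ π⁻¹(A). Over a ∈ A their fibres are cells of Gⁿ carrying the top n layers of the
-- original cells, so χ_b(X_a) is the sum e_A of the weights of these top layers, whatever a is.
-- Restricting each of these cells to the cells B of a partition of A gives a partition of
-- X ∩ π⁻¹(A) into cells whose layers are the top layers followed by those of B; the weights
-- multiply, and summing gives χ_b(A) e_A. Selecting the cells in X above A is possible since
-- membership in a definable set is decidable by o-minimality.

open import Defs

open import Data.Empty using (⊥; ⊥-elim)
open import Data.Fin using (Fin; _↑ˡ_; _↑ʳ_; inject₁; fromℕ) renaming (zero to fz; suc to fs)
import Data.Fin as Fin
open import Data.Integer using (ℤ; 0ℤ; 1ℤ; -1ℤ; -_; _*_) renaming (_+_ to _+ℤ_)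
import Data.Integer.Properties as ℤ
open import Data.List using (List; []; _∷_; map; foldr; cartesianProductWith; filter)
import Data.List as List
import Data.List.Properties as List
open import Data.List.Membership.Propositional using (_∈_; _∉_; lose)
open import Data.List.Membership.Propositional.Properties
  using (∈-lookup; ∈-++⁺ʳ; ∈-++⁻; ∈-filter⁺; ∈-filter⁻; ∈-AllPairs₂)
open import Data.List.Relation.Unary.All as All using (All; []; _∷_)
import Data.List.Relation.Unary.All.Properties as All
open import Data.List.Relation.Unary.AllPairs as AllPairs using (AllPairs; []; _∷_)
import Data.List.Relation.Unary.AllPairs.Properties as AllPairs
open import Data.List.Relation.Unary.Any as Any using (Any; here; there)
import Data.List.Relation.Unary.Any.Properties as Any
open import Data.Maybe using (just; nothing)
open import Data.Nat using (ℕ; zero; suc; _+_)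
open import Data.Nat.Properties using (+-suc; +-identityʳ; +-comm; suc-injective)
open import Data.Product using (Σ; ∃; _×_; _,_; proj₁; proj₂)
import Data.Product as Product
open import Data.Sum using (_⊎_; inj₁; inj₂; [_,_]′)
import Data.Sum as Sum
open import Data.Unit using (⊤; tt)
open import Data.Vec using (Vec; []; _∷_; init; last; take; drop; _∷ʳ_; _++_; lookup; cast; initLast; [_])
open import Data.Vec.Properties
  using ( take++drop≡id; ++-injectiveˡ; ++-injectiveʳ; cast-is-id; cast-trans; cast-sym; cast-∷ʳ
        ; ++-∷ʳ-eqFree; ∷ʳ-++-eqFree; ++-identityʳ-eqFree; unfold-∷ʳ-eqFree; init-∷ʳ; last-∷ʳ
        ; lookup-++ˡ; lookup-++ʳ; lookup-splitAt; lookup-cast₁ )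
open import Data.Vec.Relation.Binary.Pointwise.Extensional using (ext; Pointwise-≡⇒≡)
open import Function using (_∘_; id)
open import Relation.Binary.Definitions using (Symmetric)
open import Relation.Binary.PropositionalEquality
  using (_≡_; _≢_; refl; sym; trans; cong; cong₂; subst; subst₂; setoid; module ≡-Reasoning)
open import Relation.Binary.Structures using (IsStrictTotalOrder)
open import Relation.Nullary using (¬_; Dec; yes; no)
open import Relation.Nullary.Decidable using (_×-dec_; map′)

private variable
  A B C : Set

sumℤ : (A → ℤ) → List A → ℤ
sumℤ w = foldr (λ x s → w x +ℤ s) 0ℤ

sumℤ-cong : {v w : A → ℤ} → (∀ x → v x ≡ w x) → ∀ xs → sumℤ v xs ≡ sumℤ w xs
sumℤ-cong v≗w []       = refl
sumℤ-cong v≗w (x ∷ xs) = cong₂ _+ℤ_ (v≗w x) (sumℤ-cong v≗w xs)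

sumℤ-++ : (w : A → ℤ) (xs ys : List A) → sumℤ w (xs List.++ ys) ≡ sumℤ w xs +ℤ sumℤ w ys
sumℤ-++ w []       ys = sym (ℤ.+-identityˡ _)
sumℤ-++ w (x ∷ xs) ys = trans (cong (w x +ℤ_) (sumℤ-++ w xs ys)) (sym (ℤ.+-assoc (w x) _ _))

sumℤ-map : (w : B → ℤ) (f : A → B) (xs : List A) → sumℤ w (map f xs) ≡ sumℤ (w ∘ f) xs
sumℤ-map w f []       = refl
sumℤ-map w f (x ∷ xs) = cong (w (f x) +ℤ_) (sumℤ-map w f xs)

sumℤ-*ˡ : (c : ℤ) (w : A → ℤ) (xs : List A) → sumℤ (λ x → c * w x) xs ≡ c * sumℤ w xs
sumℤ-*ˡ c w []       = sym (ℤ.*-zeroʳ c)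
sumℤ-*ˡ c w (x ∷ xs) =
  trans (cong (c * w x +ℤ_) (sumℤ-*ˡ c w xs)) (sym (ℤ.*-distribˡ-+ c (w x) _))

module _ (f : A → B → C) where

  sumℤ-cartesianProductWith : (w : C → ℤ) (u : A → ℤ) (v : B → ℤ) →
    (∀ a b → w (f a b) ≡ u a * v b) →
    ∀ as bs → sumℤ w (cartesianProductWith f as bs) ≡ sumℤ u as * sumℤ v bs
  sumℤ-cartesianProductWith w u v w≡u*v []       bs = refl
  sumℤ-cartesianProductWith w u v w≡u*v (a ∷ as) bs = begin
    sumℤ w (map (f a) bs List.++ cartesianProductWith f as bs)
      ≡⟨ sumℤ-++ w (map (f a) bs) _ ⟩
    sumℤ w (map (f a) bs) +ℤ sumℤ w (cartesianProductWith f as bs)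
      ≡⟨ cong₂ _+ℤ_ row (sumℤ-cartesianProductWith w u v w≡u*v as bs) ⟩
    u a * sumℤ v bs +ℤ sumℤ u as * sumℤ v bs
      ≡⟨ ℤ.*-distribʳ-+ (sumℤ v bs) (u a) (sumℤ u as) ⟨
    (u a +ℤ sumℤ u as) * sumℤ v bs ∎
    where
    open ≡-Reasoning
    row : sumℤ w (map (f a) bs) ≡ u a * sumℤ v bs
    row = trans (sumℤ-map w (f a) bs) (trans (sumℤ-cong (w≡u*v a) bs) (sumℤ-*ˡ (u a) v bs))

  AllPairs-cartesianProductWith⁺ : ∀ {R : C → C → Set} {as bs} →
    AllPairs (λ a a′ → ∀ b b′ → R (f a b) (f a′ b′)) as →
    AllPairs (λ b b′ → ∀ a → R (f a b) (f a b′)) bs →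
    AllPairs R (cartesianProductWith f as bs)
  AllPairs-cartesianProductWith⁺            []          _   = []
  AllPairs-cartesianProductWith⁺ {bs = bs} (Ra ∷ Ras) Rbs =
    AllPairs.++⁺ (AllPairs.map⁺ (AllPairs.map (λ r → r _) Rbs))
                 (AllPairs-cartesianProductWith⁺ Ras Rbs)
                 (All.map⁺ (All.tabulate λ {b} _ →
                   All.cartesianProductWith⁺ (setoid _) (setoid _) f _ bs λ a′∈ _ → All.lookup Ra a′∈ b _))

AllPairs-lookup : ∀ {R : A → A → Set} → Symmetric R → ∀ {xs} → AllPairs R xs →
                  ∀ {i j} → i ≢ j → R (List.lookup xs i) (List.lookup xs j)
AllPairs-lookup sym-R (Rx ∷ Rxs) {fz}   {fz}   i≢j = ⊥-elim (i≢j refl)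
AllPairs-lookup sym-R (Rx ∷ Rxs) {fz}   {fs j} i≢j = All.lookup Rx (∈-lookup j)
AllPairs-lookup sym-R (Rx ∷ Rxs) {fs i} {fz}   i≢j = sym-R (All.lookup Rx (∈-lookup i))
AllPairs-lookup sym-R (Rx ∷ Rxs) {fs i} {fs j} i≢j = AllPairs-lookup sym-R Rxs (i≢j ∘ cong fs)

map-proj₁-toList : ∀ {P : A → Set} {xs} (ps : All P xs) → map proj₁ (All.toList ps) ≡ xs
map-proj₁-toList []       = refl
map-proj₁-toList (p ∷ ps) = cong (_ ∷_) (map-proj₁-toList ps)

≐-refl : {P : A → Set} → P ≐ P
≐-refl v = id , id

≐-sym : {P Q : A → Set} → P ≐ Q → Q ≐ P
≐-sym P≐Q v = proj₂ (P≐Q v) , proj₁ (P≐Q v)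

≐-trans : {P Q R : A → Set} → P ≐ Q → Q ≐ R → P ≐ R
≐-trans P≐Q Q≐R v = proj₁ (Q≐R v) ∘ proj₁ (P≐Q v) , proj₂ (P≐Q v) ∘ proj₂ (Q≐R v)

peel≡ : ∀ {j r N} → j + suc r ≡ suc N → j + r ≡ N
peel≡ {j} {r} e = suc-injective (trans (sym (+-suc j r)) e)

init∷ʳlast : ∀ {n} (v : Vec A (suc n)) → v ≡ init v ∷ʳ last v
init∷ʳlast v = proj₂ (proj₂ (initLast v))

take-++ : ∀ {m n} (xs : Vec A m) (ys : Vec A n) → take m (xs ++ ys) ≡ xs
take-++ {m = m} xs ys = ++-injectiveˡ (take m (xs ++ ys)) xs (take++drop≡id m (xs ++ ys))

drop-++ : ∀ {m n} (xs : Vec A m) (ys : Vec A n) → drop m (xs ++ ys) ≡ ys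
drop-++ {m = m} xs ys = ++-injectiveʳ (take m (xs ++ ys)) xs (take++drop≡id m (xs ++ ys))

cast-cancel : ∀ {m n} .(e : m ≡ n) (v : Vec A n) → cast e (cast (sym e) v) ≡ v
cast-cancel e v = trans (cast-trans (sym e) e v) (cast-is-id _ v)

cast-++-[] : ∀ {j N} .(e : j + 0 ≡ N) .(e₀ : j ≡ N) (y : Vec A j) → cast e (y ++ []) ≡ cast e₀ y
cast-++-[] e e₀ y = begin
  cast e (y ++ [])                       ≡⟨ cong (cast e) (cast-sym _ (++-identityʳ-eqFree y)) ⟨
  cast e (cast (sym (+-identityʳ _)) y)  ≡⟨ cast-trans _ e y ⟩
  cast e₀ y                              ∎
  where open ≡-Reasoning

cast-++-∷ʳ : ∀ {j r N} .(e : j + suc r ≡ suc N) (y : Vec A j) (z : Vec A r) t →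
             cast e (y ++ (z ∷ʳ t)) ≡ cast (peel≡ e) (y ++ z) ∷ʳ t
cast-++-∷ʳ e y z t = begin
  cast e (y ++ (z ∷ʳ t))           ≡⟨ cong (cast e) (++-∷ʳ-eqFree t y z) ⟨
  cast e (cast _ ((y ++ z) ∷ʳ t))  ≡⟨ cast-trans _ e ((y ++ z) ∷ʳ t) ⟩
  cast _ ((y ++ z) ∷ʳ t)           ≡⟨ cast-∷ʳ _ t (y ++ z) ⟩
  cast (peel≡ e) (y ++ z) ∷ʳ t     ∎
  where open ≡-Reasoning

init-cast-++ : ∀ {j r N} .(e : j + suc r ≡ suc N) (y : Vec A j) (z : Vec A (suc r)) →
               init (cast e (y ++ z)) ≡ cast (peel≡ e) (y ++ init z)
init-cast-++ e y z = begin
  init (cast e (y ++ z))                         ≡⟨ cong (λ z → init (cast e (y ++ z))) (init∷ʳlast z) ⟩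
  init (cast e (y ++ (init z ∷ʳ last z)))        ≡⟨ cong init (cast-++-∷ʳ e y (init z) (last z)) ⟩
  init (cast (peel≡ e) (y ++ init z) ∷ʳ last z)  ≡⟨ init-∷ʳ (last z) _ ⟩
  cast (peel≡ e) (y ++ init z)                   ∎
  where open ≡-Reasoning

last-cast-++ : ∀ {j r N} .(e : j + suc r ≡ suc N) (y : Vec A j) (z : Vec A (suc r)) →
               last (cast e (y ++ z)) ≡ last z
last-cast-++ e y z = begin
  last (cast e (y ++ z))                         ≡⟨ cong (λ z → last (cast e (y ++ z))) (init∷ʳlast z) ⟩
  last (cast e (y ++ (init z ∷ʳ last z)))        ≡⟨ cong last (cast-++-∷ʳ e y (init z) (last z)) ⟩
  last (cast (peel≡ e) (y ++ init z) ∷ʳ last z)  ≡⟨ last-∷ʳ (last z) (cast (peel≡ e) (y ++ init z)) ⟩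
  last z                                         ∎
  where open ≡-Reasoning

-- Layers and their weights

data Layer : Set where
  graphᴸ boundedᴸ halfᴸ fullᴸ : Layer

data Regular : Layer → Set where
  graphᴸ   : Regular graphᴸ
  boundedᴸ : Regular boundedᴸ

regular? : ∀ l → Dec (Regular l)
regular? graphᴸ   = yes graphᴸ
regular? boundedᴸ = yes boundedᴸ
regular? halfᴸ    = no λ ()
regular? fullᴸ    = no λ ()

layerWeight : Layer → ℤ
layerWeight graphᴸ   = 1ℤ
layerWeight boundedᴸ = -1ℤ
layerWeight halfᴸ    = 0ℤ
layerWeight fullᴸ    = 0ℤ

weight : List Layer → ℤ
weight = foldr (λ l w → layerWeight l * w) 1ℤ

weight-++ : ∀ ls ms → weight (ls List.++ ms) ≡ weight ls * weight ms
weight-++ []       ms = sym (ℤ.*-identityˡ _)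
weight-++ (l ∷ ls) ms =
  trans (cong (layerWeight l *_) (weight-++ ls ms)) (sym (ℤ.*-assoc (layerWeight l) _ _))

weight-irregular : ∀ ls → ¬ All Regular ls → weight ls ≡ 0ℤ
weight-irregular []              irr = ⊥-elim (irr [])
weight-irregular (graphᴸ ∷ ls)   irr = trans (ℤ.*-identityˡ _) (weight-irregular ls (irr ∘ (graphᴸ ∷_)))
weight-irregular (boundedᴸ ∷ ls) irr =
  trans (cong (-1ℤ *_) (weight-irregular ls (irr ∘ (boundedᴸ ∷_)))) (ℤ.*-zeroʳ -1ℤ)
weight-irregular (halfᴸ ∷ ls)    irr = refl
weight-irregular (fullᴸ ∷ ls)    irr = refl

module _ (𝓜 : OMinExpansion) where

  open OMinExpansion 𝓜
  open IsStrictTotalOrder isStrictTotalOrder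
    using (_<?_; _≟_) renaming (irrefl to <-irrefl; trans to <-trans; asym to <-asym)

  -- Definable sets

  Def-⊤ : ∀ n → Def n (λ _ → ⊤)
  Def-⊤ n = Def-ext (λ _ → (λ _ → tt) , (λ _ ())) (Def-∁ (Def-∅ n))

  Def-cast : ∀ {a b} (e : a ≡ b) {P : Vec G a → Set} → Def a P → Def b (λ v → P (cast (sym e) v))
  Def-cast refl {P} = Def-ext λ v → subst P (sym (cast-is-id refl v)) , subst P (cast-is-id refl v)

  Def-∃suffix : ∀ M {K} {S : Vec G (K + M) → Set} → Def (K + M) S →
                Def K (λ w → ∃ λ (u : Vec G M) → S (w ++ u))
  Def-∃suffix zero {K} {S} d = Def-ext
    (λ w → (λ s → [] , subst S w≡w++[] s) , (λ { ([] , s) → subst S (sym w≡w++[]) s }))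
    (Def-cast (+-identityʳ K) d)
    where
    w≡w++[] : ∀ {w} → cast (sym (+-identityʳ K)) w ≡ w ++ []
    w≡w++[] {w} = cast-sym _ (++-identityʳ-eqFree w)
  Def-∃suffix (suc M) {K} {S} d = Def-ext
    (λ w → (λ { (t , u , s) → t ∷ u , subst S (∷ʳ-++-eqFree t w) s })
         , (λ { (t ∷ u , s) → t , u , subst S (sym (∷ʳ-++-eqFree t w)) s }))
    (Def-proj (Def-∃suffix M {suc K} (Def-cast (+-suc K M) d)))

  Def-drop : ∀ K {M} {P : Vec G M → Set} → Def M P → Def (K + M) (λ v → P (drop K v))
  Def-drop zero    d = d
  Def-drop (suc K) d = Def-ext (λ { (x ∷ v) → id , id }) (Def-G× (Def-drop K d))

  Def-lookup≡ : ∀ {L} (i : Fin L) (c : G) → Def L (λ v → lookup v i ≡ c)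
  Def-lookup≡ {suc L} fz     c = Def-head≡ L
    where
    Def-head≡ : ∀ k → Def (suc k) (λ v → lookup v fz ≡ c)
    Def-head≡ zero    = Def-ext (λ { (x ∷ []) → id , id }) (Def-const c)
    Def-head≡ (suc k) = Def-ext (λ { (x ∷ y ∷ v) → id , id }) (Def-×G (Def-head≡ k))
  Def-lookup≡ {suc L} (fs i) c = Def-ext (λ { (x ∷ v) → id , id }) (Def-G× (Def-lookup≡ i c))

  Def-Π : ∀ {n} M {Q : Fin M → Vec G n → Set} → (∀ i → Def n (Q i)) → Def n (λ v → ∀ i → Q i v)
  Def-Π zero    _  = Def-ext (λ v → (λ _ ()) , (λ _ → tt)) (Def-⊤ _)
  Def-Π (suc M) dQ = Def-ext
    (λ v → (λ { (q₀ , qs) → λ { fz → q₀ ; (fs i) → qs i } }) , (λ q → q fz , q ∘ fs))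
    (Def-∩ (dQ fz) (Def-Π M (dQ ∘ fs)))

  Coordinate : ℕ → Set
  Coordinate K = G ⊎ Fin K

  coordinate : ∀ {K} → Coordinate K → Vec G K → G
  coordinate (inj₁ c) w = c
  coordinate (inj₂ j) w = lookup w j

  IsCoordinate : ∀ {K} → (Vec G K → G) → Set
  IsCoordinate {K} f = Σ (Coordinate K) λ s → ∀ w → f w ≡ coordinate s w

  IsCoordinateMap : ∀ {K M} → (Vec G K → Vec G M) → Set
  IsCoordinateMap {K} {M} ρ =
    Σ (Fin M → Coordinate K) λ σ → ∀ w i → lookup (ρ w) i ≡ coordinate (σ i) w

  -- P (ρ w) holds iff some u with P u satisfies the coordinate equations u i = σ i (w),
  -- which are definable; projecting u away leaves a definable set.
  Def-preimage : ∀ {K M} {P : Vec G M → Set} → Def M P →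
                 {ρ : Vec G K → Vec G M} → IsCoordinateMap ρ → Def K (λ w → P (ρ w))
  Def-preimage {K} {M} {P} d {ρ} (σ , ρ≗σ) =
    Def-ext (λ w → to w , from w) (Def-∃suffix M (Def-∩ (Def-drop K d) (Def-Π M Def-coordinate)))
    where
    coordinate′ : Coordinate K → Vec G (K + M) → G
    coordinate′ (inj₁ c) v = c
    coordinate′ (inj₂ j) v = lookup v (j ↑ˡ M)
    coordinate′-++ : ∀ s w (u : Vec G M) → coordinate′ s (w ++ u) ≡ coordinate s w
    coordinate′-++ (inj₁ c) w u = refl
    coordinate′-++ (inj₂ j) w u = lookup-++ˡ w u j
    Def-coordinate : ∀ i → Def (K + M) (λ v → lookup v (K ↑ʳ i) ≡ coordinate′ (σ i) v)
    Def-coordinate i with σ i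
    ... | inj₁ c = Def-lookup≡ (K ↑ʳ i) c
    ... | inj₂ j = Def-eq (K + M) (K ↑ʳ i) (j ↑ˡ M)
    Solution : Vec G K → Vec G M → Set
    Solution w u = P (drop K (w ++ u)) × (∀ i → lookup (w ++ u) (K ↑ʳ i) ≡ coordinate′ (σ i) (w ++ u))
    to : ∀ w → ∃ (Solution w) → P (ρ w)
    to w (u , p , u≗σ) = subst P (trans (drop-++ w u) (Pointwise-≡⇒≡ (ext λ i → begin
      lookup u i                  ≡⟨ lookup-++ʳ w u i ⟨
      lookup (w ++ u) (K ↑ʳ i)    ≡⟨ u≗σ i ⟩
      coordinate′ (σ i) (w ++ u)  ≡⟨ coordinate′-++ (σ i) w u ⟩
      coordinate (σ i) w          ≡⟨ ρ≗σ w i ⟨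
      lookup (ρ w) i              ∎))) p
      where open ≡-Reasoning
    from : ∀ w → P (ρ w) → ∃ (Solution w)
    from w p = ρ w , subst P (sym (drop-++ w (ρ w))) p ,
      λ i → trans (lookup-++ʳ w (ρ w) i) (trans (ρ≗σ w i) (sym (coordinate′-++ (σ i) w (ρ w))))

  coordinateMap-cong : ∀ {K M} {ρ ρ′ : Vec G K → Vec G M} → (∀ w → ρ w ≡ ρ′ w) →
                       IsCoordinateMap ρ → IsCoordinateMap ρ′
  coordinateMap-cong ρ≗ρ′ (σ , ρ≗σ) =
    σ , λ w i → trans (cong (λ v → lookup v i) (sym (ρ≗ρ′ w))) (ρ≗σ w i)

  coordinateMap-id : ∀ {K} → IsCoordinateMap {K} id
  coordinateMap-id = inj₂ , λ w i → refl

  coordinateMap-const : ∀ {K M} (a : Vec G M) → IsCoordinateMap {K} (λ _ → a)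
  coordinateMap-const a = (λ i → inj₁ (lookup a i)) , λ w i → refl

  coordinateMap-++ : ∀ {K M₁ M₂} {ρ₁ : Vec G K → Vec G M₁} {ρ₂ : Vec G K → Vec G M₂} →
                     IsCoordinateMap ρ₁ → IsCoordinateMap ρ₂ → IsCoordinateMap (λ w → ρ₁ w ++ ρ₂ w)
  coordinateMap-++ {M₁ = M₁} {ρ₁ = ρ₁} {ρ₂} (σ₁ , ρ₁≗σ₁) (σ₂ , ρ₂≗σ₂) = σ , ρ≗σ
    where
    σ = λ i → [ σ₁ , σ₂ ]′ (Fin.splitAt M₁ i)
    ρ≗σ : ∀ w i → lookup (ρ₁ w ++ ρ₂ w) i ≡ coordinate (σ i) w
    ρ≗σ w i with Fin.splitAt M₁ i | lookup-splitAt M₁ (ρ₁ w) (ρ₂ w) i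
    ... | inj₁ j | eq = trans eq (ρ₁≗σ₁ w j)
    ... | inj₂ j | eq = trans eq (ρ₂≗σ₂ w j)

  coordinateMap-cast : ∀ {K M M′} .(e : M ≡ M′) {ρ : Vec G K → Vec G M} →
                       IsCoordinateMap ρ → IsCoordinateMap (λ w → cast e (ρ w))
  coordinateMap-cast e {ρ} (σ , ρ≗σ) =
    (λ i → σ (Fin.cast (sym e) i)) , λ w i → trans (lookup-cast₁ e (ρ w) i) (ρ≗σ w _)

  coordinateMap-init : ∀ {K M} {ρ : Vec G K → Vec G (suc M)} →
                       IsCoordinateMap ρ → IsCoordinateMap (λ w → init (ρ w))
  coordinateMap-init {ρ = ρ} (σ , ρ≗σ) =
    (λ i → σ (inject₁ i)) , λ w i → trans (lookup-init (ρ w) i) (ρ≗σ w _)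
    where
    lookup-init : ∀ {n} (v : Vec G (suc n)) i → lookup (init v) i ≡ lookup v (inject₁ i)
    lookup-init (x ∷ y ∷ v) fz     = refl
    lookup-init (x ∷ y ∷ v) (fs i) = lookup-init (y ∷ v) i

  coordinate-last : ∀ {K M} {ρ : Vec G K → Vec G (suc M)} →
                    IsCoordinateMap ρ → IsCoordinate (λ w → last (ρ w))
  coordinate-last {M = M} {ρ = ρ} (σ , ρ≗σ) =
    σ (fromℕ M) , λ w → trans (lookup-last (ρ w)) (ρ≗σ w _)
    where
    lookup-last : ∀ {n} (v : Vec G (suc n)) → last v ≡ lookup v (fromℕ n)
    lookup-last (x ∷ [])    = refl
    lookup-last (x ∷ y ∷ v) = lookup-last (y ∷ v)

  coordinateMap-[_] : ∀ {K} {f : Vec G K → G} → IsCoordinate f → IsCoordinateMap (λ w → [ f w ])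
  coordinateMap-[ s , f≗s ] = (λ _ → s) , λ { w fz → f≗s w }

  coordinateMap-∷ʳ : ∀ {K M} {ρ : Vec G K → Vec G M} {f : Vec G K → G} →
                     IsCoordinateMap ρ → IsCoordinate f → IsCoordinateMap (λ w → ρ w ∷ʳ f w)
  coordinateMap-∷ʳ {M = M} {ρ} {f} cρ cf =
    coordinateMap-cong (λ w → cast-sym _ (unfold-∷ʳ-eqFree (f w) (ρ w)))
      (coordinateMap-cast (sym (+-comm 1 M)) {λ w → ρ w ++ [ f w ]}
        (coordinateMap-++ {ρ₁ = ρ} {ρ₂ = λ w → [ f w ]} cρ coordinateMap-[ cf ]))

  last-coordinate : ∀ {K} → IsCoordinate (last {n = K})
  last-coordinate = coordinate-last {ρ = id} coordinateMap-id

  init-coordinates : ∀ {K} → IsCoordinateMap (init {n = K})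
  init-coordinates = coordinateMap-init {ρ = id} coordinateMap-id

  Def-last≡ : ∀ {N} (c : G) → Def (suc N) (λ w → last w ≡ c)
  Def-last≡ c = Def-preimage (Def-const c) {λ w → [ last w ]} coordinateMap-[ last-coordinate ]

  Def-> : Def 2 (λ p → lookup p (fs fz) < lookup p fz)
  Def-> = Def-preimage Def-< {λ p → lookup p (fs fz) ∷ lookup p fz ∷ []}
    ((λ { fz → inj₂ (fs fz) ; (fs fz) → inj₂ fz }) , λ { p fz → refl ; p (fs fz) → refl })

  inPiece? : ∀ p t → Dec (inPiece _<_ p t)
  inPiece? (point a)      t = t ≟ a
  inPiece? (interval l u) t = lower? l ×-dec upper? u
    where
    lower? : ∀ l → Dec (lowerOK _<_ l t)
    lower? nothing  = yes tt
    lower? (just a) = a <? t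
    upper? : ∀ u → Dec (upperOK _<_ u t)
    upper? nothing  = yes tt
    upper? (just b) = t <? b

  definable₁? : ∀ {X : Vec G 1 → Set} → Def 1 X → ∀ v → Dec (X v)
  definable₁? {X} d v with o-minimal X d
  ... | ps , X≐ps = map′ (proj₂ (X≐ps v)) (proj₁ (X≐ps v)) (Any.any? (λ p → inPiece? p (lookup v fz)) ps)

  definable? : ∀ N {X : Vec G N → Set} → Def N X → ∀ v → Dec (X v)
  definable? zero    d []    = definable₁? (Def-×G d) [ 0# ]
  definable? (suc N) {X} d v =
    map′ to from (definable? N (Def-proj (Def-∩ d (Def-last≡ (last v)))) (init v))
    where
    to : (∃ λ t → X (init v ∷ʳ t) × last (init v ∷ʳ t) ≡ last v) → X v
    to (t , x , t≡) =
      subst X (trans (cong (init v ∷ʳ_) (trans (sym (last-∷ʳ t (init v))) t≡)) (sym (init∷ʳlast v))) x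
    from : X v → ∃ λ t → X (init v ∷ʳ t) × last (init v ∷ʳ t) ≡ last v
    from x = last v , subst X (init∷ʳlast v) x , last-∷ʳ (last v) (init v)

  -- Cells

  ⟦_⟧ᶜ : ∀ {n} → Cell 𝓜 n → Vec G n → Set
  ⟦_⟧ᶜ = ⟦ 𝓜 ⟧

  aboveL? : ∀ {n} (l : Bound 𝓜 n) x t → Dec (aboveL 𝓜 l x t)
  aboveL? nothing  x t = yes tt
  aboveL? (just f) x t = f x <? t

  belowU? : ∀ {n} (u : Bound 𝓜 n) x t → Dec (belowU 𝓜 u x t)
  belowU? nothing  x t = yes tt
  belowU? (just g) x t = t <? g x

  cell? : ∀ {n} (C : Cell 𝓜 n) v → Dec (⟦ C ⟧ᶜ v)
  cell? pt                 v = yes tt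
  cell? (graph A f _ _)    v = cell? A (init v) ×-dec (last v ≟ f (init v))
  cell? (band A l u _ _ _) v =
    cell? A (init v) ×-dec (aboveL? l (init v) (last v) ×-dec belowU? u (init v) (last v))

  module _ {n} (P : Vec G n → Set) (Q : Vec G n → G → Set) (x : Vec G n) (t : G) where

    ∷ʳ⁻ : P (init (x ∷ʳ t)) × Q (init (x ∷ʳ t)) (last (x ∷ʳ t)) → P x × Q x t
    ∷ʳ⁻ rewrite init-∷ʳ t x | last-∷ʳ t x = id

    ∷ʳ⁺ : P x × Q x t → P (init (x ∷ʳ t)) × Q (init (x ∷ʳ t)) (last (x ∷ʳ t))
    ∷ʳ⁺ rewrite init-∷ʳ t x | last-∷ʳ t x = id

  base : ∀ {N} → Cell 𝓜 (suc N) → Cell 𝓜 N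
  base (graph A _ _ _)    = A
  base (band A _ _ _ _ _) = A

  TopCondition : ∀ {n} → Cell 𝓜 (suc n) → Vec G n → G → Set
  TopCondition (graph _ f _ _)    x t = t ≡ f x
  TopCondition (band _ l u _ _ _) x t = aboveL 𝓜 l x t × belowU 𝓜 u x t

  cell-split : ∀ {N} (C : Cell 𝓜 (suc N)) v →
               ⟦ C ⟧ᶜ v ≡ (⟦ base C ⟧ᶜ (init v) × TopCondition C (init v) (last v))
  cell-split (graph _ _ _ _)    v = refl
  cell-split (band _ _ _ _ _ _) v = refl

  ∷ʳ-cell⁻ : ∀ {n} (C : Cell 𝓜 (suc n)) {x t} → ⟦ C ⟧ᶜ (x ∷ʳ t) → ⟦ base C ⟧ᶜ x × TopCondition C x t
  ∷ʳ-cell⁻ C {x} {t} rewrite cell-split C (x ∷ʳ t) = ∷ʳ⁻ ⟦ base C ⟧ᶜ (TopCondition C) x t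

  ∷ʳ-cell⁺ : ∀ {n} (C : Cell 𝓜 (suc n)) {x t} → ⟦ base C ⟧ᶜ x × TopCondition C x t → ⟦ C ⟧ᶜ (x ∷ʳ t)
  ∷ʳ-cell⁺ C {x} {t} rewrite cell-split C (x ∷ʳ t) = ∷ʳ⁺ ⟦ base C ⟧ᶜ (TopCondition C) x t

  band-nonempty : ∀ {n} {A : Vec G n → Set} (l u : Bound 𝓜 n) → Below 𝓜 A l u →
                  ∀ x → A x → ∃ λ t → aboveL 𝓜 l x t × belowU 𝓜 u x t
  band-nonempty nothing  nothing  _   x a = 0# , tt , tt
  band-nonempty nothing  (just g) _   x a = let t , t<g = no-min (g x) in t , tt , t<g
  band-nonempty (just f) nothing  _   x a = let t , f<t = no-max (f x) in t , f<t , tt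
  band-nonempty (just f) (just g) f<g x a = let t , f<t , t<g = dense (f<g x a) in t , f<t , t<g

  cell-nonempty : ∀ {n} (C : Cell 𝓜 n) → ∃ ⟦ C ⟧ᶜ
  cell-nonempty pt = [] , tt
  cell-nonempty C@(graph A f _ _) =
    let x , a = cell-nonempty A in x ∷ʳ f x , ∷ʳ-cell⁺ C (a , refl)
  cell-nonempty C@(band A l u _ _ l<u) =
    let x , a = cell-nonempty A ; t , lt = band-nonempty l u l<u x a in x ∷ʳ t , ∷ʳ-cell⁺ C (a , lt)

  sample : ∀ {k} → Cell 𝓜 k → Vec G k
  sample C = proj₁ (cell-nonempty C)

  sample∈ : ∀ {k} (C : Cell 𝓜 k) → ⟦ C ⟧ᶜ (sample C)
  sample∈ C = proj₂ (cell-nonempty C)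

  base-sem : ∀ {N} (C : Cell 𝓜 (suc N)) → ⟦ base C ⟧ᶜ ≐ (λ x → ∃ λ t → ⟦ C ⟧ᶜ (x ∷ʳ t))
  base-sem C@(graph A f _ _) x =
    (λ a → f x , ∷ʳ-cell⁺ C (a , refl)) , (λ { (t , c) → proj₁ (∷ʳ-cell⁻ C c) })
  base-sem C@(band A l u _ _ l<u) x =
    (λ a → let t , lt = band-nonempty l u l<u x a in t , ∷ʳ-cell⁺ C (a , lt)) ,
    (λ { (t , c) → proj₁ (∷ʳ-cell⁻ C c) })

  Def-graph-compare : ∀ {n} {A : Vec G n → Set} {f : Vec G n → G} {R : G → G → Set} →
                      DefFunOn 𝓜 A f → Def 2 (λ p → R (lookup p fz) (lookup p (fs fz))) →
                      Def (suc n) (λ v → A (init v) × R (f (init v)) (last v))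
  Def-graph-compare {n} {A} {f} {R} Γ dR = Def-ext (λ v → to v , from v) (Def-proj (Def-∩ Γ′ dR′))
    where
    drop-penultimate : Vec G (suc (suc n)) → Vec G (suc n)
    drop-penultimate w = init (init w) ∷ʳ last w
    Γ′ = Def-preimage Γ {drop-penultimate}
      (coordinateMap-∷ʳ {ρ = init ∘ init} (coordinateMap-init {ρ = init} init-coordinates) last-coordinate)
    dR′ = Def-preimage dR {λ w → [ last w ] ∷ʳ last (init w)}
      (coordinateMap-∷ʳ {ρ = λ w → [ last w ]} coordinateMap-[ last-coordinate ]
                        (coordinate-last {ρ = init} init-coordinates))
    Graph : Vec G (suc n) → Set
    Graph v = A (init v) × last v ≡ f (init v)
    drop-penultimate-∷ʳ : ∀ v s → drop-penultimate (v ∷ʳ s) ≡ init v ∷ʳ s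
    drop-penultimate-∷ʳ v s = cong₂ _∷ʳ_ (cong init (init-∷ʳ s v)) (last-∷ʳ s v)
    Witness : Vec G (suc n) → G → Set
    Witness v s = Graph (drop-penultimate (v ∷ʳ s)) × R (last (v ∷ʳ s)) (last (init (v ∷ʳ s)))
    to : ∀ v → ∃ (Witness v) → A (init v) × R (f (init v)) (last v)
    to v (s , γ , r) with ∷ʳ⁻ A (λ x s → s ≡ f x) (init v) s (subst Graph (drop-penultimate-∷ʳ v s) γ)
    ... | a , refl rewrite last-∷ʳ (f (init v)) v | init-∷ʳ (f (init v)) v = a , r
    from : ∀ v → A (init v) × R (f (init v)) (last v) → ∃ (Witness v)
    from v (a , r) = f (init v) ,
      subst Graph (sym (drop-penultimate-∷ʳ v _)) (∷ʳ⁺ A (λ x s → s ≡ f x) (init v) _ (a , refl)) ,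
      subst₂ R (sym (last-∷ʳ _ v)) (cong last (sym (init-∷ʳ _ v))) r

  Def-cell : ∀ {n} (C : Cell 𝓜 n) → Def n ⟦ C ⟧ᶜ
  Def-cell pt              = Def-⊤ 0
  Def-cell (graph A f Γ _) = Γ
  Def-cell (band A l u l-ok u-ok _) =
    Def-ext (λ v → (λ { ((a , p) , (_ , q)) → a , p , q }) , (λ { (a , p , q) → (a , p) , (a , q) }))
            (Def-∩ (Def-lower l l-ok) (Def-upper u u-ok))
    where
    Def-lower : ∀ l → BoundOK 𝓜 ⟦ A ⟧ᶜ l → Def _ (λ v → ⟦ A ⟧ᶜ (init v) × aboveL 𝓜 l (init v) (last v))
    Def-lower nothing  _       = Def-ext (λ v → (λ a → a , tt) , proj₁) (Def-×G (Def-cell A))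
    Def-lower (just f) (Γ , _) = Def-graph-compare {A = ⟦ A ⟧ᶜ} {f} {_<_} Γ Def-<
    Def-upper : ∀ u → BoundOK 𝓜 ⟦ A ⟧ᶜ u → Def _ (λ v → ⟦ A ⟧ᶜ (init v) × belowU 𝓜 u (init v) (last v))
    Def-upper nothing  _       = Def-ext (λ v → (λ a → a , tt) , proj₁) (Def-×G (Def-cell A))
    Def-upper (just g) (Γ , _) = Def-graph-compare {A = ⟦ A ⟧ᶜ} {g} {λ s t → t < s} Γ Def->

  -- Shadows: projections onto the first j coordinates

  -- The split N = j + r is an explicit equation so that the last coordinate can be peeled off
  -- by recursion on r: j + suc r is not definitionally suc (j + r).
  Shadow : ∀ {N} j r → j + r ≡ N → (Vec G N → Set) → Vec G j → Set
  Shadow j r e S y = ∃ λ (z : Vec G r) → S (cast e (y ++ z))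

  Shadow-cong : ∀ {N} j r (e : j + r ≡ N) {S S′ : Vec G N → Set} → S ≐ S′ → Shadow j r e S ≐ Shadow j r e S′
  Shadow-cong j r e S≐S′ y =
    (λ { (z , s) → z , proj₁ (S≐S′ _) s }) , (λ { (z , s) → z , proj₂ (S≐S′ _) s })

  Shadow-zero : ∀ {N} j (e : j + 0 ≡ N) (e₀ : j ≡ N) (S : Vec G N → Set) →
                Shadow j 0 e S ≐ (λ y → S (cast e₀ y))
  Shadow-zero j e e₀ S y =
    (λ { ([] , s) → subst S (cast-++-[] e e₀ y) s }) , (λ s → [] , subst S (sym (cast-++-[] e e₀ y)) s)

  Shadow-suc : ∀ {N} j r (e : j + suc r ≡ suc N) (S : Vec G (suc N) → Set) →
               Shadow j (suc r) e S ≐ Shadow j r (peel≡ e) (λ w → ∃ λ t → S (w ∷ʳ t))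
  Shadow-suc j r e S y =
    (λ { (z , s) → init z , last z , subst S (split z) s }) ,
    (λ { (z , t , s) → z ∷ʳ t , subst S (sym (cast-++-∷ʳ e y z t)) s })
    where
    split : ∀ z → cast e (y ++ z) ≡ cast (peel≡ e) (y ++ init z) ∷ʳ last z
    split z = trans (cong (λ z → cast e (y ++ z)) (init∷ʳlast z)) (cast-++-∷ʳ e y (init z) (last z))

  Shadow-base : ∀ {m n N} (e : m + suc n ≡ suc N) (C : Cell 𝓜 (suc N)) →
                Shadow m (suc n) e ⟦ C ⟧ᶜ ⊆ Shadow m n (peel≡ e) ⟦ base C ⟧ᶜ
  Shadow-base {m} {n} e C a a∈ =
    proj₂ (Shadow-cong m n (peel≡ e) (base-sem C) a) (proj₁ (Shadow-suc m n e ⟦ C ⟧ᶜ a) a∈)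

  proj≐Shadow : ∀ {N} j r (e : j + r ≡ N) (S : Vec G N → Set) →
                proj 𝓜 j {r} (subst (λ k → Vec G k → Set) (sym e) S) ≐ Shadow j r e S
  proj≐Shadow j r refl S y =
    (λ { (v , s , refl) → drop j v , subst S (trans (sym (take++drop≡id j v)) (sym (cast-is-id refl _))) s }) ,
    (λ { (z , s) → cast refl (y ++ z) , s , trans (cong (take j) (cast-is-id refl (y ++ z))) (take-++ y z) })

  +-suc≢0 : ∀ {j r} → j + suc r ≢ 0
  +-suc≢0 {j} {r} e with trans (sym (+-suc j r)) e
  ... | ()

  shadowCell : ∀ {N} j r → j + r ≡ N → Cell 𝓜 N → Cell 𝓜 j
  shadowCell j zero    e C                  = subst (Cell 𝓜) (trans (sym e) (+-identityʳ j)) C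
  shadowCell j (suc r) e pt                 = ⊥-elim (+-suc≢0 e)
  shadowCell j (suc r) e (graph A _ _ _)    = shadowCell j r (peel≡ e) A
  shadowCell j (suc r) e (band A _ _ _ _ _) = shadowCell j r (peel≡ e) A

  subst-cell-sem : ∀ {N j} (e : N ≡ j) (C : Cell 𝓜 N) →
                   ⟦ subst (Cell 𝓜) e C ⟧ᶜ ≐ (λ y → ⟦ C ⟧ᶜ (cast (sym e) y))
  subst-cell-sem refl C y = subst ⟦ C ⟧ᶜ (sym (cast-is-id _ y)) , subst ⟦ C ⟧ᶜ (cast-is-id _ y)

  shadowCell-sem : ∀ {N} j r (e : j + r ≡ N) (C : Cell 𝓜 N) →
                   ⟦ shadowCell j r e C ⟧ᶜ ≐ Shadow j r e ⟦ C ⟧ᶜ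
  shadowCell-sem j zero e C =
    ≐-trans (subst-cell-sem e₀ C) (≐-sym (Shadow-zero j e (sym e₀) ⟦ C ⟧ᶜ))
    where e₀ = trans (sym e) (+-identityʳ j)
  shadowCell-sem j (suc r) e pt = ⊥-elim (+-suc≢0 e)
  shadowCell-sem j (suc r) e C@(graph A _ _ _) =
    ≐-trans (shadowCell-sem j r (peel≡ e) A)
            (≐-trans (Shadow-cong j r (peel≡ e) (base-sem C)) (≐-sym (Shadow-suc j r e ⟦ C ⟧ᶜ)))
  shadowCell-sem j (suc r) e C@(band A _ _ _ _ _) =
    ≐-trans (shadowCell-sem j r (peel≡ e) A)
            (≐-trans (Shadow-cong j r (peel≡ e) (base-sem C)) (≐-sym (Shadow-suc j r e ⟦ C ⟧ᶜ)))

  bandLayer : ∀ {n} → Bound 𝓜 n → Bound 𝓜 n → Layer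
  bandLayer nothing  nothing  = fullᴸ
  bandLayer nothing  (just _) = halfᴸ
  bandLayer (just _) nothing  = halfᴸ
  bandLayer (just _) (just _) = boundedᴸ

  topLayer : ∀ {N} → Cell 𝓜 (suc N) → Layer
  topLayer (graph _ _ _ _)    = graphᴸ
  topLayer (band _ l u _ _ _) = bandLayer l u

  layers : ∀ {N} → Cell 𝓜 N → List Layer
  layers pt                 = []
  layers (graph A _ _ _)    = graphᴸ ∷ layers A
  layers (band A l u _ _ _) = bandLayer l u ∷ layers A

  topLayers : ∀ {N} → ℕ → Cell 𝓜 N → List Layer
  topLayers zero    C                  = []
  topLayers (suc r) pt                 = []
  topLayers (suc r) (graph A _ _ _)    = graphᴸ ∷ topLayers r A
  topLayers (suc r) (band A l u _ _ _) = bandLayer l u ∷ topLayers r A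

  cellWeight : ∀ {N} → Cell 𝓜 N → ℤ
  cellWeight C = weight (layers C)

  topLayer∈layers : ∀ {N} (C : Cell 𝓜 (suc N)) → topLayer C ∈ layers C
  topLayer∈layers (graph _ _ _ _)    = here refl
  topLayer∈layers (band _ _ _ _ _ _) = here refl

  topLayers⊆layers : ∀ {N} r (C : Cell 𝓜 N) {l} → l ∈ topLayers r C → l ∈ layers C
  topLayers⊆layers (suc r) (graph A _ _ _)    (here refl) = here refl
  topLayers⊆layers (suc r) (graph A _ _ _)    (there l∈)  = there (topLayers⊆layers r A l∈)
  topLayers⊆layers (suc r) (band A _ _ _ _ _) (here refl) = here refl
  topLayers⊆layers (suc r) (band A _ _ _ _ _) (there l∈)  = there (topLayers⊆layers r A l∈)

  layers-subst : ∀ {N j} (e : N ≡ j) (C : Cell 𝓜 N) → layers (subst (Cell 𝓜) e C) ≡ layers C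
  layers-subst refl C = refl

  layers-shadowCell : ∀ {N} j r (e : j + r ≡ N) (C : Cell 𝓜 N) →
                      layers C ≡ topLayers r C List.++ layers (shadowCell j r e C)
  layers-shadowCell j zero    e C                  = sym (layers-subst (trans (sym e) (+-identityʳ j)) C)
  layers-shadowCell j (suc r) e pt                 = ⊥-elim (+-suc≢0 e)
  layers-shadowCell j (suc r) e (graph A _ _ _)    =
    cong (graphᴸ ∷_) (layers-shadowCell j r (peel≡ e) A)
  layers-shadowCell j (suc r) e (band A l u _ _ _) =
    cong (bandLayer l u ∷_) (layers-shadowCell j r (peel≡ e) A)

  -- Exceptional and bad cells

  total-fibre⇒full : ∀ {k} (P : Cell 𝓜 (suc k)) x → (∀ t → ⟦ P ⟧ᶜ (x ∷ʳ t)) → topLayer P ≡ fullᴸ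
  total-fibre⇒full P@(graph A f _ _) x total =
    let t , f<t = no-max (f x) in ⊥-elim (<-irrefl (sym (proj₂ (∷ʳ-cell⁻ P (total t)))) f<t)
  total-fibre⇒full P@(band A (just f) u _ _ _) x total =
    let t , t<f = no-min (f x) in ⊥-elim (<-asym t<f (proj₁ (proj₂ (∷ʳ-cell⁻ P (total t)))))
  total-fibre⇒full P@(band A nothing (just g) _ _ _) x total =
    let t , g<t = no-max (g x) in ⊥-elim (<-asym g<t (proj₂ (proj₂ (∷ʳ-cell⁻ P (total t)))))
  total-fibre⇒full (band A nothing nothing _ _ _) x total = refl

  lower-ray-fibre⇒half : ∀ {k} (P : Cell 𝓜 (suc k)) x c →
    (∀ t → ⟦ P ⟧ᶜ (x ∷ʳ t) → t < c) → (∀ t → t < c → ⟦ P ⟧ᶜ (x ∷ʳ t)) → topLayer P ≡ halfᴸ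
  lower-ray-fibre⇒half P@(graph A f _ _) x c _ ray =
    let t₂ , t₂<c  = no-min c ; t₁ , t₁<t₂ = no-min t₂
        t₁≡f = proj₂ (∷ʳ-cell⁻ P (ray t₁ (<-trans t₁<t₂ t₂<c)))
        t₂≡f = proj₂ (∷ʳ-cell⁻ P (ray t₂ t₂<c))
    in  ⊥-elim (<-irrefl (trans t₁≡f (sym t₂≡f)) t₁<t₂)
  lower-ray-fibre⇒half P@(band A nothing nothing _ _ _) x c fibre ray =
    let t , t<c = no-min c ; a , _ = ∷ʳ-cell⁻ P (ray t t<c)
    in  ⊥-elim (<-irrefl refl (fibre c (∷ʳ-cell⁺ P (a , tt , tt))))
  lower-ray-fibre⇒half (band A nothing (just _) _ _ _) x c _ _ = refl
  lower-ray-fibre⇒half (band A (just _) nothing _ _ _) x c _ _ = refl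
  lower-ray-fibre⇒half P@(band A (just f) (just g) _ _ _) x c _ ray =
    let t₀ , t₀<c = no-min c ; _ , f<t₀ , _ = ∷ʳ-cell⁻ P (ray t₀ t₀<c) ; t , t<f = no-min (f x)
        f<t = proj₁ (proj₂ (∷ʳ-cell⁻ P (ray t (<-trans t<f (<-trans f<t₀ t₀<c)))))
    in  ⊥-elim (<-asym t<f f<t)

  upper-ray-fibre⇒half : ∀ {k} (P : Cell 𝓜 (suc k)) x c →
    (∀ t → ⟦ P ⟧ᶜ (x ∷ʳ t) → c < t) → (∀ t → c < t → ⟦ P ⟧ᶜ (x ∷ʳ t)) → topLayer P ≡ halfᴸ
  upper-ray-fibre⇒half P@(graph A f _ _) x c _ ray =
    let t₁ , c<t₁ = no-max c ; t₂ , t₁<t₂ = no-max t₁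
        t₁≡f = proj₂ (∷ʳ-cell⁻ P (ray t₁ c<t₁))
        t₂≡f = proj₂ (∷ʳ-cell⁻ P (ray t₂ (<-trans c<t₁ t₁<t₂)))
    in  ⊥-elim (<-irrefl (trans t₁≡f (sym t₂≡f)) t₁<t₂)
  upper-ray-fibre⇒half P@(band A nothing nothing _ _ _) x c fibre ray =
    let t , c<t = no-max c ; a , _ = ∷ʳ-cell⁻ P (ray t c<t)
    in  ⊥-elim (<-irrefl refl (fibre c (∷ʳ-cell⁺ P (a , tt , tt))))
  upper-ray-fibre⇒half (band A nothing (just _) _ _ _) x c _ _ = refl
  upper-ray-fibre⇒half (band A (just _) nothing _ _ _) x c _ _ = refl
  upper-ray-fibre⇒half P@(band A (just f) (just g) _ _ _) x c _ ray =
    let t₀ , c<t₀ = no-max c ; _ , _ , t₀<g = ∷ʳ-cell⁻ P (ray t₀ c<t₀) ; t , g<t = no-max (g x)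
        t<g = proj₂ (proj₂ (∷ʳ-cell⁻ P (ray t (<-trans c<t₀ (<-trans t₀<g g<t)))))
    in  ⊥-elim (<-asym g<t t<g)

  IsCylinder : ∀ {k} → (Vec G (suc k) → Set) → Set
  IsCylinder {k} S = ∃ λ (A : Cell 𝓜 k) → S ≐ (λ v → ⟦ A ⟧ᶜ (init v))

  IsHalfCylinder : ∀ {k} → (Vec G (suc k) → Set) → Set
  IsHalfCylinder {k} S = ∃ λ (A : Cell 𝓜 k) → ∃ λ (f : Vec G k → G) → DefFunOn 𝓜 ⟦ A ⟧ᶜ f ×
    (  (S ≐ (λ v → ⟦ A ⟧ᶜ (init v) × (last v < f (init v))))
     ⊎ (S ≐ (λ v → ⟦ A ⟧ᶜ (init v) × (f (init v) < last v))))

  -- Exceptional 𝓜 C is AtSomeProjection IsCylinder C, and Bad 𝓜 C is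
  -- ¬ Exceptional 𝓜 C × AtSomeProjection IsHalfCylinder C, both by definition.
  AtSomeProjection : (∀ {k} → (Vec G (suc k) → Set) → Set) → ∀ {N} → Cell 𝓜 N → Set
  AtSomeProjection Φ {N} C = ∃ λ k → ∃ λ r → Σ (suc k + r ≡ N) λ eq → Φ (pSet 𝓜 k r eq ⟦ C ⟧ᶜ)

  Respects≐ : (∀ {k} → (Vec G (suc k) → Set) → Set) → Set₁
  Respects≐ Φ = ∀ {k} {S S′ : Vec G (suc k) → Set} → S ≐ S′ → Φ S → Φ S′

  IsCylinder-resp : Respects≐ IsCylinder
  IsCylinder-resp S≐S′ (A , S≐) = A , ≐-trans (≐-sym S≐S′) S≐

  IsHalfCylinder-resp : Respects≐ IsHalfCylinder
  IsHalfCylinder-resp S≐S′ (A , f , Γ , S≐) =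
    A , f , Γ , Sum.map (≐-trans (≐-sym S≐S′)) (≐-trans (≐-sym S≐S′)) S≐

  shadowCell≐pSet : ∀ {N} k r (eq : suc k + r ≡ N) (C : Cell 𝓜 N) →
                    ⟦ shadowCell (suc k) r eq C ⟧ᶜ ≐ pSet 𝓜 k r eq ⟦ C ⟧ᶜ
  shadowCell≐pSet k r eq C =
    ≐-trans (shadowCell-sem (suc k) r eq C) (≐-sym (proj≐Shadow (suc k) r eq ⟦ C ⟧ᶜ))

  AtSomeProjection⇒layer : ∀ {Φ : ∀ {k} → (Vec G (suc k) → Set) → Set} → Respects≐ Φ →
    ∀ {N} (C : Cell 𝓜 N) → AtSomeProjection Φ C →
    ∃ λ k → ∃ λ (P : Cell 𝓜 (suc k)) → topLayer P ∈ layers C × Φ ⟦ P ⟧ᶜ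
  AtSomeProjection⇒layer resp C (k , r , eq , φ) =
    k , P ,
    subst (topLayer P ∈_) (sym (layers-shadowCell (suc k) r eq C))
                          (∈-++⁺ʳ (topLayers r C) (topLayer∈layers P)) ,
    resp (≐-sym (shadowCell≐pSet k r eq C)) φ
    where P = shadowCell (suc k) r eq C

  pSet-base : ∀ {N} k r (eq : suc k + r ≡ N) (C : Cell 𝓜 (suc N)) →
              pSet 𝓜 k (suc r) (trans (+-suc (suc k) r) (cong suc eq)) ⟦ C ⟧ᶜ ≐ pSet 𝓜 k r eq ⟦ base C ⟧ᶜ
  pSet-base k r eq C =
    ≐-trans (proj≐Shadow (suc k) (suc r) e ⟦ C ⟧ᶜ)
      (≐-trans (Shadow-suc (suc k) r e ⟦ C ⟧ᶜ)
        (≐-trans (Shadow-cong (suc k) r eq (≐-sym (base-sem C)))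
                 (≐-sym (proj≐Shadow (suc k) r eq ⟦ base C ⟧ᶜ))))
    where e = trans (+-suc (suc k) r) (cong suc eq)

  pSet-top : ∀ {N} (C : Cell 𝓜 (suc N)) → pSet 𝓜 N 0 (+-identityʳ (suc N)) ⟦ C ⟧ᶜ ≐ ⟦ C ⟧ᶜ
  pSet-top {N} C =
    ≐-trans (proj≐Shadow (suc N) 0 (+-identityʳ (suc N)) ⟦ C ⟧ᶜ)
      (≐-trans (Shadow-zero (suc N) (+-identityʳ (suc N)) refl ⟦ C ⟧ᶜ)
               (λ y → subst ⟦ C ⟧ᶜ (cast-is-id _ y) , subst ⟦ C ⟧ᶜ (sym (cast-is-id _ y))))

  module _ {Φ : ∀ {k} → (Vec G (suc k) → Set) → Set} (resp : Respects≐ Φ) where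

    AtSomeProjection-base : ∀ {N} (C : Cell 𝓜 (suc N)) → AtSomeProjection Φ (base C) → AtSomeProjection Φ C
    AtSomeProjection-base C (k , r , eq , φ) =
      k , suc r , trans (+-suc (suc k) r) (cong suc eq) , resp (≐-sym (pSet-base k r eq C)) φ

    AtSomeProjection-top : ∀ {N} (C : Cell 𝓜 (suc N)) → Φ ⟦ C ⟧ᶜ → AtSomeProjection Φ C
    AtSomeProjection-top {N} C φ = N , 0 , +-identityʳ (suc N) , resp (≐-sym (pSet-top C)) φ

  cylinder⇒full : ∀ {k} (P : Cell 𝓜 (suc k)) → IsCylinder ⟦ P ⟧ᶜ → topLayer P ≡ fullᴸ
  cylinder⇒full P (A , P≐) =
    let v , p = cell-nonempty P ; a = proj₁ (P≐ v) p
    in  total-fibre⇒full P (init v) λ t → proj₂ (P≐ _) (subst ⟦ A ⟧ᶜ (sym (init-∷ʳ t (init v))) a)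

  halfCylinder⇒half : ∀ {k} (P : Cell 𝓜 (suc k)) → IsHalfCylinder ⟦ P ⟧ᶜ → topLayer P ≡ halfᴸ
  halfCylinder⇒half P (A , f , _ , inj₁ P≐) =
    let v , p = cell-nonempty P ; a , _ = proj₁ (P≐ v) p ; x = init v ; Q = λ x t → t < f x
    in  lower-ray-fibre⇒half P x (f x)
          (λ t q → proj₂ (∷ʳ⁻ ⟦ A ⟧ᶜ Q x t (proj₁ (P≐ _) q)))
          (λ t t<f → proj₂ (P≐ _) (∷ʳ⁺ ⟦ A ⟧ᶜ Q x t (a , t<f)))
  halfCylinder⇒half P (A , f , _ , inj₂ P≐) =
    let v , p = cell-nonempty P ; a , _ = proj₁ (P≐ v) p ; x = init v ; Q = λ x t → f x < t
    in  upper-ray-fibre⇒half P x (f x)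
          (λ t q → proj₂ (∷ʳ⁻ ⟦ A ⟧ᶜ Q x t (proj₁ (P≐ _) q)))
          (λ t f<t → proj₂ (P≐ _) (∷ʳ⁺ ⟦ A ⟧ᶜ Q x t (a , f<t)))

  exceptional⇒full : ∀ {N} (C : Cell 𝓜 N) → Exceptional 𝓜 C → fullᴸ ∈ layers C
  exceptional⇒full C exc =
    let _ , P , P∈ , cylinder = AtSomeProjection⇒layer IsCylinder-resp C exc
    in  subst (_∈ layers C) (cylinder⇒full P cylinder) P∈

  bad⇒half : ∀ {N} (C : Cell 𝓜 N) → Bad 𝓜 C → halfᴸ ∈ layers C
  bad⇒half C (_ , half) =
    let _ , P , P∈ , halfCylinder = AtSomeProjection⇒layer IsHalfCylinder-resp C half
    in  subst (_∈ layers C) (halfCylinder⇒half P halfCylinder) P∈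

  full⇒exceptional : ∀ {N} (C : Cell 𝓜 N) → fullᴸ ∈ layers C → Exceptional 𝓜 C
  full⇒exceptional C@(graph A _ _ _) (there full∈) =
    AtSomeProjection-base IsCylinder-resp C (full⇒exceptional A full∈)
  full⇒exceptional C@(band A nothing nothing _ _ _) (here refl) =
    AtSomeProjection-top IsCylinder-resp C (A , λ v → proj₁ , λ a → a , tt , tt)
  full⇒exceptional (band A nothing  (just _) _ _ _) (here ())
  full⇒exceptional (band A (just _) nothing  _ _ _) (here ())
  full⇒exceptional (band A (just _) (just _) _ _ _) (here ())
  full⇒exceptional C@(band A _ _ _ _ _) (there full∈) =
    AtSomeProjection-base IsCylinder-resp C (full⇒exceptional A full∈)

  half⇒halfCylinder : ∀ {N} (C : Cell 𝓜 N) → halfᴸ ∈ layers C → AtSomeProjection IsHalfCylinder C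
  half⇒halfCylinder C@(graph A _ _ _) (there half∈) =
    AtSomeProjection-base IsHalfCylinder-resp C (half⇒halfCylinder A half∈)
  half⇒halfCylinder C@(band A nothing (just g) _ (Γ , _) _) (here refl) =
    AtSomeProjection-top IsHalfCylinder-resp C
      (A , g , Γ , inj₁ λ v → (λ { (a , _ , q) → a , q }) , (λ { (a , q) → a , tt , q }))
  half⇒halfCylinder C@(band A (just f) nothing (Γ , _) _ _) (here refl) =
    AtSomeProjection-top IsHalfCylinder-resp C
      (A , f , Γ , inj₂ λ v → (λ { (a , p , _) → a , p }) , (λ { (a , p) → a , p , tt }))
  half⇒halfCylinder (band A nothing  nothing  _ _ _) (here ())
  half⇒halfCylinder (band A (just _) (just _) _ _ _) (here ())
  half⇒halfCylinder C@(band A _ _ _ _ _) (there half∈) =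
    AtSomeProjection-base IsHalfCylinder-resp C (half⇒halfCylinder A half∈)

  nonExceptional⇒noFull : ∀ {N} (C : Cell 𝓜 N) → ¬ Exceptional 𝓜 C → fullᴸ ∉ layers C
  nonExceptional⇒noFull C ¬exc = ¬exc ∘ full⇒exceptional C

  noFull⇒nonExceptional : ∀ {N} (C : Cell 𝓜 N) → fullᴸ ∉ layers C → ¬ Exceptional 𝓜 C
  noFull⇒nonExceptional C noFull = noFull ∘ exceptional⇒full C

  good⇒regular : ∀ {N} (C : Cell 𝓜 N) → Good 𝓜 C → All Regular (layers C)
  good⇒regular C (¬exc , ¬bad) = All.tabulate (regular _)
    where
    regular : ∀ l → l ∈ layers C → Regular l
    regular graphᴸ   _     = graphᴸ
    regular boundedᴸ _     = boundedᴸ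
    regular halfᴸ    half∈ = ⊥-elim (¬bad (¬exc , half⇒halfCylinder C half∈))
    regular fullᴸ    full∈ = ⊥-elim (¬exc (full⇒exceptional C full∈))

  regular⇒good : ∀ {N} (C : Cell 𝓜 N) → All Regular (layers C) → Good 𝓜 C
  regular⇒good C regular =
    (λ exc → irregular-full (All.lookup regular (exceptional⇒full C exc))) ,
    (λ bad → irregular-half (All.lookup regular (bad⇒half C bad)))
    where
    irregular-full : ¬ Regular fullᴸ
    irregular-full ()
    irregular-half : ¬ Regular halfᴸ
    irregular-half ()

  good? : ∀ {N} (C : Cell 𝓜 N) → Dec (Good 𝓜 C)
  good? C = map′ (regular⇒good C) (good⇒regular C) (All.all? regular? (layers C))

  sign-dim≡weight : ∀ {N} (C : Cell 𝓜 N) → All Regular (layers C) → sign (dim 𝓜 C) ≡ cellWeight C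
  sign-dim≡weight pt []                                            = refl
  sign-dim≡weight (graph A _ _ _) (_ ∷ regular)                    =
    trans (sign-dim≡weight A regular) (sym (ℤ.*-identityˡ _))
  sign-dim≡weight (band A (just _) (just _) _ _ _) (_ ∷ regular)   =
    trans (cong -_ (sign-dim≡weight A regular)) (sym (ℤ.-1*i≡-i _))
  sign-dim≡weight (band A nothing  nothing  _ _ _) (() ∷ _)
  sign-dim≡weight (band A nothing  (just _) _ _ _) (() ∷ _)
  sign-dim≡weight (band A (just _) nothing  _ _ _) (() ∷ _)

  contrib≡cellWeight : ∀ {N} (C : Cell 𝓜 N) (good : Dec (Good 𝓜 C)) → contrib 𝓜 (C , good) ≡ cellWeight C
  contrib≡cellWeight C (yes good) = sign-dim≡weight C (good⇒regular C good)
  contrib≡cellWeight C (no ¬good) = sym (weight-irregular (layers C) (¬good ∘ regular⇒good C))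

  -- Fibres

  InBox-cong : ∀ {n} {lo lo′ hi hi′ x x′ : Vec G n} → lo ≡ lo′ → hi ≡ hi′ → x ≡ x′ →
               InBox 𝓜 lo hi x → InBox 𝓜 lo′ hi′ x′
  InBox-cong refl refl refl box = box

  InBox-++⁻ : ∀ {m n} (lo₁ hi₁ x₁ : Vec G m) {lo₂ hi₂ x₂ : Vec G n} →
              InBox 𝓜 (lo₁ ++ lo₂) (hi₁ ++ hi₂) (x₁ ++ x₂) → InBox 𝓜 lo₁ hi₁ x₁ × InBox 𝓜 lo₂ hi₂ x₂
  InBox-++⁻ []        []        []       box = (λ ()) , box
  InBox-++⁻ (_ ∷ lo₁) (_ ∷ hi₁) (_ ∷ x₁) box =
    let box₁ , box₂ = InBox-++⁻ lo₁ hi₁ x₁ (box ∘ fs) in (λ { fz → box fz ; (fs i) → box₁ i }) , box₂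

  InBox-++⁺ : ∀ {m n} (lo₁ hi₁ x₁ : Vec G m) {lo₂ hi₂ x₂ : Vec G n} →
              InBox 𝓜 lo₁ hi₁ x₁ → InBox 𝓜 lo₂ hi₂ x₂ → InBox 𝓜 (lo₁ ++ lo₂) (hi₁ ++ hi₂) (x₁ ++ x₂)
  InBox-++⁺ []        []        []       _    box₂ = box₂
  InBox-++⁺ (_ ∷ lo₁) (_ ∷ hi₁) (_ ∷ x₁) box₁ box₂ =
    λ { fz → box₁ fz ; (fs i) → InBox-++⁺ lo₁ hi₁ x₁ (box₁ ∘ fs) box₂ i }

  BoxContinuous : ∀ {n N} → (Vec G n → Vec G N) → Set
  BoxContinuous {n} ι = ∀ y lo hi → InBox 𝓜 lo hi (ι y) →
    ∃ λ (lo′ : Vec G n) → ∃ λ (hi′ : Vec G n) →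
      InBox 𝓜 lo′ hi′ y × (∀ y′ → InBox 𝓜 lo′ hi′ y′ → InBox 𝓜 lo hi (ι y′))

  id-continuous : ∀ {n} → BoxContinuous {n} id
  id-continuous y lo hi box = lo , hi , box , λ _ box′ → box′

  cast-++-continuous : ∀ {m n N} (e : m + n ≡ N) (a : Vec G m) → BoxContinuous (λ y → cast e (a ++ y))
  cast-++-continuous {m} refl a y lo hi box =
    drop m lo , drop m hi , proj₂ (split box) , λ y′ box′ →
      InBox-cong (take++drop≡id m lo) (take++drop≡id m hi) (sym (cast-is-id refl (a ++ y′)))
                 (InBox-++⁺ (take m lo) (take m hi) a (proj₁ (split box)) box′)
    where
    split : InBox 𝓜 lo hi (cast refl (a ++ y)) →
            InBox 𝓜 (take m lo) (take m hi) a × InBox 𝓜 (drop m lo) (drop m hi) y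
    split = InBox-++⁻ (take m lo) (take m hi) a
          ∘ InBox-cong (sym (take++drop≡id m lo)) (sym (take++drop≡id m hi)) (cast-is-id refl (a ++ y))

  ContOn-∘ : ∀ {n N} {S : Vec G N → Set} {S′ : Vec G n → Set} {ι : Vec G n → Vec G N} {f : Vec G N → G} →
             (∀ y → S′ y → S (ι y)) → BoxContinuous ι → ContOn 𝓜 S f → ContOn 𝓜 S′ (λ y → f (ι y))
  ContOn-∘ {ι = ι} S′⊆S∘ι ι-continuous f-continuous y s′ α β α<f fι<β =
    let lo , hi , box , inside = f-continuous (ι y) (S′⊆S∘ι y s′) α β α<f fι<β
        lo′ , hi′ , box′ , into = ι-continuous y lo hi box
    in  lo′ , hi′ , box′ , λ y′ s″ box″ → inside (ι y′) (S′⊆S∘ι y′ s″) (into y′ box″)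

  _∘ᴮ_ : ∀ {n N} → Bound 𝓜 N → (Vec G n → Vec G N) → Bound 𝓜 n
  nothing ∘ᴮ ι = nothing
  just f  ∘ᴮ ι = just (f ∘ ι)

  aboveL-∘ᴮ : ∀ {n N} (l : Bound 𝓜 N) (ι : Vec G n → Vec G N) y t →
              aboveL 𝓜 (l ∘ᴮ ι) y t ≡ aboveL 𝓜 l (ι y) t
  aboveL-∘ᴮ nothing  ι y t = refl
  aboveL-∘ᴮ (just f) ι y t = refl

  belowU-∘ᴮ : ∀ {n N} (u : Bound 𝓜 N) (ι : Vec G n → Vec G N) y t →
              belowU 𝓜 (u ∘ᴮ ι) y t ≡ belowU 𝓜 u (ι y) t
  belowU-∘ᴮ nothing  ι y t = refl
  belowU-∘ᴮ (just g) ι y t = refl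

  bandLayer-∘ᴮ : ∀ {n N} (l u : Bound 𝓜 N) (ι : Vec G n → Vec G N) →
                 bandLayer (l ∘ᴮ ι) (u ∘ᴮ ι) ≡ bandLayer l u
  bandLayer-∘ᴮ nothing  nothing  ι = refl
  bandLayer-∘ᴮ nothing  (just _) ι = refl
  bandLayer-∘ᴮ (just _) nothing  ι = refl
  bandLayer-∘ᴮ (just _) (just _) ι = refl

  Below-∘ᴮ : ∀ {n N} {S : Vec G N → Set} {S′ : Vec G n → Set} {ι : Vec G n → Vec G N} →
             (∀ y → S′ y → S (ι y)) → ∀ l u → Below 𝓜 S l u → Below 𝓜 S′ (l ∘ᴮ ι) (u ∘ᴮ ι)
  Below-∘ᴮ S′⊆S∘ι nothing  nothing  _   = tt
  Below-∘ᴮ S′⊆S∘ι nothing  (just _) _   = tt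
  Below-∘ᴮ S′⊆S∘ι (just _) nothing  _   = tt
  Below-∘ᴮ S′⊆S∘ι (just _) (just _) f<g = λ y s′ → f<g _ (S′⊆S∘ι y s′)

  DefFunOn-fibre : ∀ {m n N} (e : m + n ≡ N) (a : Vec G m) {S : Vec G N → Set} {S′ : Vec G n → Set} →
    S′ ≐ (λ y → S (cast e (a ++ y))) → ∀ {f} → DefFunOn 𝓜 S f → DefFunOn 𝓜 S′ (λ y → f (cast e (a ++ y)))
  DefFunOn-fibre {m} {n} {N} e a {S} {S′} S′≐ {f} Γ =
    Def-ext (λ v → to v , from v)
      (Def-preimage Γ {λ v → cast e′ (a ++ v)} (coordinateMap-cast e′ {λ v → a ++ v}
        (coordinateMap-++ {ρ₁ = λ _ → a} {ρ₂ = id} (coordinateMap-const a) coordinateMap-id)))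
    where
    e′ : m + suc n ≡ suc N
    e′ = trans (+-suc m n) (cong suc e)
    Graph : Vec G (suc N) → Set
    Graph w = S (init w) × last w ≡ f (init w)
    to : ∀ v → Graph (cast e′ (a ++ v)) → S′ (init v) × last v ≡ f (cast e (a ++ init v))
    to v (s , t≡) rewrite init-cast-++ e′ a v | last-cast-++ e′ a v = proj₂ (S′≐ (init v)) s , t≡
    from : ∀ v → S′ (init v) × last v ≡ f (cast e (a ++ init v)) → Graph (cast e′ (a ++ v))
    from v (s′ , t≡) rewrite init-cast-++ e′ a v | last-cast-++ e′ a v = proj₁ (S′≐ (init v)) s′ , t≡

  BoundOK-fibre : ∀ {m n N} (e : m + n ≡ N) (a : Vec G m) {S : Vec G N → Set} {S′ : Vec G n → Set} →
    S′ ≐ (λ y → S (cast e (a ++ y))) → ∀ l → BoundOK 𝓜 S l → BoundOK 𝓜 S′ (l ∘ᴮ (λ y → cast e (a ++ y)))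
  BoundOK-fibre e a          S′≐ nothing  _            = tt
  BoundOK-fibre e a {S} {S′} S′≐ (just f) (Γ , f-cont) =
    DefFunOn-fibre e a {S} {S′} S′≐ {f} Γ , ContOn-∘ (λ y → proj₁ (S′≐ y)) (cast-++-continuous e a) f-cont

  cell-cast-++ : ∀ {m n N} (e : m + suc n ≡ suc N) (C : Cell 𝓜 (suc N)) a →
    (λ v → ⟦ base C ⟧ᶜ (cast (peel≡ e) (a ++ init v)) × TopCondition C (cast (peel≡ e) (a ++ init v)) (last v))
    ≐ (λ v → ⟦ C ⟧ᶜ (cast e (a ++ v)))
  cell-cast-++ e C a v
    rewrite cell-split C (cast e (a ++ v)) | init-cast-++ e a v | last-cast-++ e a v = id , id

  cell-preimage : ∀ {n N} (D : Cell 𝓜 (suc n)) (C : Cell 𝓜 (suc N)) (ι : Vec G n → Vec G N) →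
    ⟦ base D ⟧ᶜ ≐ (λ x → ⟦ base C ⟧ᶜ (ι x)) → (∀ x t → TopCondition D x t ≡ TopCondition C (ι x) t) →
    ⟦ D ⟧ᶜ ≐ (λ v → ⟦ base C ⟧ᶜ (ι (init v)) × TopCondition C (ι (init v)) (last v))
  cell-preimage D C ι base≐ top≡ v rewrite cell-split D v | top≡ (init v) (last v) =
    (λ { (d , t) → proj₁ (base≐ (init v)) d , t }) , (λ { (c , t) → proj₂ (base≐ (init v)) c , t })

  mutual
    fibre : ∀ {N} m n (e : m + n ≡ N) (C : Cell 𝓜 N) (a : Vec G m) → Shadow m n e ⟦ C ⟧ᶜ a → Cell 𝓜 n
    fibre m zero    e C                      a _  = pt
    fibre m (suc n) e pt                     a _  = ⊥-elim (+-suc≢0 e)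
    fibre m (suc n) e C@(graph A f Γ f-cont) a a∈ =
      graph F (f ∘ ι) (DefFunOn-fibre (peel≡ e) a {⟦ A ⟧ᶜ} F-sem {f} Γ)
            (ContOn-∘ (λ y → proj₁ (F-sem y)) (cast-++-continuous (peel≡ e) a) f-cont)
      where
      ι = λ y → cast (peel≡ e) (a ++ y)
      F = fibre m n (peel≡ e) A a (Shadow-base e C a a∈)
      F-sem = fibre-sem m n (peel≡ e) A a (Shadow-base e C a a∈)
    fibre m (suc n) e C@(band A l u l-ok u-ok l<u) a a∈ =
      band F (l ∘ᴮ ι) (u ∘ᴮ ι)
           (BoundOK-fibre (peel≡ e) a F-sem l l-ok) (BoundOK-fibre (peel≡ e) a F-sem u u-ok)
           (Below-∘ᴮ (λ y → proj₁ (F-sem y)) l u l<u)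
      where
      ι = λ y → cast (peel≡ e) (a ++ y)
      F = fibre m n (peel≡ e) A a (Shadow-base e C a a∈)
      F-sem = fibre-sem m n (peel≡ e) A a (Shadow-base e C a a∈)

    fibre-sem : ∀ {N} m n (e : m + n ≡ N) (C : Cell 𝓜 N) (a : Vec G m) (a∈ : Shadow m n e ⟦ C ⟧ᶜ a) →
                ⟦ fibre m n e C a a∈ ⟧ᶜ ≐ (λ y → ⟦ C ⟧ᶜ (cast e (a ++ y)))
    fibre-sem m zero    e C                 a ([] , c) [] = (λ _ → c) , (λ _ → tt)
    fibre-sem m (suc n) e pt                a _           = ⊥-elim (+-suc≢0 e)
    fibre-sem m (suc n) e C@(graph A f _ _) a a∈          =
      ≐-trans (cell-preimage (fibre m (suc n) e C a a∈) C (λ y → cast (peel≡ e) (a ++ y))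
                             (fibre-sem m n (peel≡ e) A a (Shadow-base e C a a∈)) (λ x t → refl))
              (cell-cast-++ e C a)
    fibre-sem m (suc n) e C@(band A l u _ _ _) a a∈       =
      ≐-trans (cell-preimage (fibre m (suc n) e C a a∈) C ι (fibre-sem m n (peel≡ e) A a (Shadow-base e C a a∈))
                             (λ x t → cong₂ _×_ (aboveL-∘ᴮ l ι x t) (belowU-∘ᴮ u ι x t)))
              (cell-cast-++ e C a)
      where ι = λ y → cast (peel≡ e) (a ++ y)

  layers-fibre : ∀ {N} m n (e : m + n ≡ N) (C : Cell 𝓜 N) a a∈ → layers (fibre m n e C a a∈) ≡ topLayers n C
  layers-fibre m zero    e C                  a a∈ = refl
  layers-fibre m (suc n) e pt                 a a∈ = ⊥-elim (+-suc≢0 e)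
  layers-fibre m (suc n) e (graph A _ _ _)    a a∈ = cong (graphᴸ ∷_) (layers-fibre m n (peel≡ e) A a _)
  layers-fibre m (suc n) e (band A l u _ _ _) a a∈ =
    cong₂ _∷_ (bandLayer-∘ᴮ l u (λ y → cast (peel≡ e) (a ++ y))) (layers-fibre m n (peel≡ e) A a _)

  -- Restrictions of a cell to a cell of its base

  takeᵉ : ∀ {m n N} → m + n ≡ N → Vec G N → Vec G m
  takeᵉ {m} e w = take m (cast (sym e) w)

  takeᵉ-init : ∀ {m n N} (e : m + suc n ≡ suc N) (w : Vec G (suc N)) → takeᵉ (peel≡ e) (init w) ≡ takeᵉ e w
  takeᵉ-init {m} e w = begin
    take m (cast _ (init w))
      ≡⟨ cong (take m ∘ cast (sym (peel≡ e)) ∘ init) w≡ ⟨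
    take m (cast _ (init (cast e (take m x ++ drop m x))))
      ≡⟨ cong (take m ∘ cast _) (init-cast-++ e (take m x) (drop m x)) ⟩
    take m (cast _ (cast _ (take m x ++ init (drop m x))))
      ≡⟨ cong (take m) (cast-cancel (sym (peel≡ e)) _) ⟩
    take m (take m x ++ init (drop m x))
      ≡⟨ take-++ (take m x) _ ⟩
    take m x ∎
    where
    open ≡-Reasoning
    x = cast (sym e) w
    w≡ : cast e (take m x ++ drop m x) ≡ w
    w≡ = trans (cong (cast e) (take++drop≡id m x)) (cast-cancel e w)

  takeᵉ-zero : ∀ {m N} (e : m + 0 ≡ N) (e₀ : m ≡ N) (w : Vec G N) → takeᵉ e w ≡ cast (sym e₀) w
  takeᵉ-zero {m} e e₀ w = begin
    take m (cast (sym e) w)                   ≡⟨ cong (take m ∘ cast (sym e)) w≡ ⟨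
    take m (cast (sym e) (cast e (x ++ [])))  ≡⟨ cong (take m) (cast-cancel (sym e) (x ++ [])) ⟩
    take m (x ++ [])                          ≡⟨ take-++ x [] ⟩
    x                                         ∎
    where
    open ≡-Reasoning
    x = cast (sym e₀) w
    w≡ : cast e (x ++ []) ≡ w
    w≡ = trans (cast-++-[] e e₀ x) (cast-cancel e₀ w)

  DefFunOn-⊆ : ∀ {N} {R S : Vec G N → Set} → Def N R → (∀ w → R w → S w) →
               ∀ {f} → DefFunOn 𝓜 S f → DefFunOn 𝓜 R f
  DefFunOn-⊆ dR R⊆S Γ =
    Def-ext (λ v → (λ { (r , _ , t≡) → r , t≡ }) , (λ { (r , t≡) → r , R⊆S _ r , t≡ }))
            (Def-∩ (Def-×G dR) Γ)

  BoundOK-⊆ : ∀ {N} {R S : Vec G N → Set} → Def N R → (∀ w → R w → S w) →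
              ∀ l → BoundOK 𝓜 S l → BoundOK 𝓜 R l
  BoundOK-⊆ dR R⊆S nothing  _            = tt
  BoundOK-⊆ dR R⊆S (just f) (Γ , f-cont) = DefFunOn-⊆ dR R⊆S {f} Γ , ContOn-∘ R⊆S id-continuous f-cont

  Below-⊆ : ∀ {N} {R S : Vec G N → Set} → (∀ w → R w → S w) → ∀ l u → Below 𝓜 S l u → Below 𝓜 R l u
  Below-⊆ R⊆S nothing  nothing  _   = tt
  Below-⊆ R⊆S nothing  (just _) _   = tt
  Below-⊆ R⊆S (just _) nothing  _   = tt
  Below-⊆ R⊆S (just _) (just _) f<g = λ w r → f<g w (R⊆S w r)

  cell-restrict : ∀ {m n N} (e : m + suc n ≡ suc N) (D C : Cell 𝓜 (suc N)) (B : Cell 𝓜 m) →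
    ⟦ base D ⟧ᶜ ≐ (λ x → ⟦ base C ⟧ᶜ x × ⟦ B ⟧ᶜ (takeᵉ (peel≡ e) x)) →
    (∀ x t → TopCondition D x t ≡ TopCondition C x t) → ⟦ D ⟧ᶜ ≐ (λ w → ⟦ C ⟧ᶜ w × ⟦ B ⟧ᶜ (takeᵉ e w))
  cell-restrict e D C B base≐ top≡ w
    rewrite cell-split D w | cell-split C w | top≡ (init w) (last w) | sym (takeᵉ-init e w) =
    (λ { (d , t) → let c , b = proj₁ (base≐ (init w)) d in (c , t) , b }) ,
    (λ { ((c , t) , b) → proj₂ (base≐ (init w)) (c , b) , t })

  mutual
    restrict : ∀ {N} m n (e : m + n ≡ N) (B : Cell 𝓜 m) (C : Cell 𝓜 N) →
               ⟦ B ⟧ᶜ ⊆ Shadow m n e ⟦ C ⟧ᶜ → Cell 𝓜 N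
    restrict m zero    e B C                          _  = subst (Cell 𝓜) (trans (sym (+-identityʳ m)) e) B
    restrict m (suc n) e B pt                         _  = ⊥-elim (+-suc≢0 e)
    restrict m (suc n) e B C@(graph A f Γ f-cont)     B⊆ =
      graph R f (DefFunOn-⊆ (Def-cell R) R⊆A {f} Γ) (ContOn-∘ R⊆A id-continuous f-cont)
      where
      B⊆πA = λ a → Shadow-base e C a ∘ B⊆ a
      R = restrict m n (peel≡ e) B A B⊆πA
      R⊆A = λ w → proj₁ ∘ proj₁ (restrict-sem m n (peel≡ e) B A B⊆πA w)
    restrict m (suc n) e B C@(band A l u l-ok u-ok l<u) B⊆ =
      band R l u (BoundOK-⊆ (Def-cell R) R⊆A l l-ok) (BoundOK-⊆ (Def-cell R) R⊆A u u-ok) (Below-⊆ R⊆A l u l<u)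
      where
      B⊆πA = λ a → Shadow-base e C a ∘ B⊆ a
      R = restrict m n (peel≡ e) B A B⊆πA
      R⊆A = λ w → proj₁ ∘ proj₁ (restrict-sem m n (peel≡ e) B A B⊆πA w)

    restrict-sem : ∀ {N} m n (e : m + n ≡ N) (B : Cell 𝓜 m) (C : Cell 𝓜 N) (B⊆ : ⟦ B ⟧ᶜ ⊆ Shadow m n e ⟦ C ⟧ᶜ) →
                   ⟦ restrict m n e B C B⊆ ⟧ᶜ ≐ (λ w → ⟦ C ⟧ᶜ w × ⟦ B ⟧ᶜ (takeᵉ e w))
    restrict-sem m zero e B C B⊆ w =
      (λ r → let b = proj₁ (subst-cell-sem e₀ B w) r
             in  subst ⟦ C ⟧ᶜ (cast-cancel e₀ w) (proj₁ (Shadow-zero m e e₀ ⟦ C ⟧ᶜ _) (B⊆ _ b)) ,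
                 subst ⟦ B ⟧ᶜ (sym (takeᵉ-zero e e₀ w)) b) ,
      (λ { (_ , b) → proj₂ (subst-cell-sem e₀ B w) (subst ⟦ B ⟧ᶜ (takeᵉ-zero e e₀ w) b) })
      where e₀ = trans (sym (+-identityʳ m)) e
    restrict-sem m (suc n) e B pt                   B⊆ = ⊥-elim (+-suc≢0 e)
    restrict-sem m (suc n) e B C@(graph A _ _ _)    B⊆ =
      cell-restrict e (restrict m (suc n) e B C B⊆) C B
        (restrict-sem m n (peel≡ e) B A (λ a → Shadow-base e C a ∘ B⊆ a)) (λ x t → refl)
    restrict-sem m (suc n) e B C@(band A _ _ _ _ _) B⊆ =
      cell-restrict e (restrict m (suc n) e B C B⊆) C B
        (restrict-sem m n (peel≡ e) B A (λ a → Shadow-base e C a ∘ B⊆ a)) (λ x t → refl)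

  layers-restrict : ∀ {N} m n (e : m + n ≡ N) (B : Cell 𝓜 m) (C : Cell 𝓜 N) B⊆ →
                    layers (restrict m n e B C B⊆) ≡ topLayers n C List.++ layers B
  layers-restrict m zero    e B C                  _ = layers-subst (trans (sym (+-identityʳ m)) e) B
  layers-restrict m (suc n) e B pt                 _ = ⊥-elim (+-suc≢0 e)
  layers-restrict m (suc n) e B (graph A _ _ _)    _ =
    cong (graphᴸ ∷_) (layers-restrict m n (peel≡ e) B A _)
  layers-restrict m (suc n) e B (band A l u _ _ _) _ =
    cong (bandLayer l u ∷_) (layers-restrict m n (peel≡ e) B A _)

  Disjoint : ∀ {N} → Cell 𝓜 N → Cell 𝓜 N → Set
  Disjoint C C′ = ∀ v → ⟦ C ⟧ᶜ v → ⟦ C′ ⟧ᶜ v → ⊥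

  Disjoint-sym : ∀ {N} → Symmetric (Disjoint {N})
  Disjoint-sym C#C′ v c′ c = C#C′ v c c′

  record CellPartition {N} (Y : Vec G N → Set) (Cs : List (Cell 𝓜 N)) : Set where
    field
      covers         : ∀ v → Y v → Any (λ C → ⟦ C ⟧ᶜ v) Cs
      inside         : All (λ C → ⟦ C ⟧ᶜ ⊆ Y) Cs
      disjoint       : AllPairs Disjoint Cs
      nonExceptional : All (λ C → ¬ Exceptional 𝓜 C) Cs

  open CellPartition

  CellPartition-≐ : ∀ {N} {Y Y′ : Vec G N → Set} {Cs} → Y ≐ Y′ → CellPartition Y Cs → CellPartition Y′ Cs
  CellPartition-≐ Y≐Y′ P = record
    { covers         = λ v y′ → covers P v (proj₂ (Y≐Y′ v) y′)
    ; inside         = All.map (λ C⊆Y v c → proj₁ (Y≐Y′ v) (C⊆Y v c)) (inside P)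
    ; disjoint       = disjoint P
    ; nonExceptional = nonExceptional P
    }

  IsPartition⇒disjoint : ∀ {N} {Y : Vec G N → Set} {Cs} → IsPartition 𝓜 Cs Y → AllPairs Disjoint Cs
  IsPartition⇒disjoint {Cs = Cs} (_ , _ , disjoint) =
    subst (AllPairs Disjoint) (List.tabulate-lookup Cs) (AllPairs.tabulate⁺ (disjoint _ _))

  IsPartition⇒CellPartition : ∀ {N} {Y : Vec G N → Set} {Cs} → IsPartition 𝓜 Cs Y →
                              All (λ C → ¬ Exceptional 𝓜 C) Cs → CellPartition Y Cs
  IsPartition⇒CellPartition {Y = Y} P@(covered , inside , _) nonExceptional = record
    { covers         = λ v y → let i , c = covered v y in lose (∈-lookup i) c
    ; inside         = All.tabulate λ C∈ →
                         subst (λ C → ⟦ C ⟧ᶜ ⊆ Y) (sym (Any.lookup-index C∈)) (inside (Any.index C∈))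
    ; disjoint       = IsPartition⇒disjoint P
    ; nonExceptional = nonExceptional
    }

  CellPartition⇒IsPartition : ∀ {N} {Y : Vec G N → Set} {Cs} → CellPartition Y Cs → IsPartition 𝓜 Cs Y
  CellPartition⇒IsPartition P =
    (λ v y → let c = covers P v y in Any.index c , Any.lookup-index c) ,
    (λ i → All.lookup (inside P) (∈-lookup i)) ,
    (λ i j i≢j → AllPairs-lookup Disjoint-sym (disjoint P) i≢j)

  χᵇ-partition : ∀ {N} {Y : Vec G N → Set} {Cs} → CellPartition Y Cs → ChiB 𝓜 Y (sumℤ cellWeight Cs)
  χᵇ-partition {Y = Y} {Cs} P =
    F , subst (λ Ds → IsPartition 𝓜 Ds Y) (sym cells-F) (CellPartition⇒IsPartition P) ,
    All.map⁺ (nonExceptional P) ,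
    sym (trans (sumℤ-map (contrib 𝓜) _ Cs) (sumℤ-cong (λ C → contrib≡cellWeight C (good? C)) Cs))
    where
    F = map (λ C → C , good? C) Cs
    cells-F : map proj₁ F ≡ Cs
    cells-F = trans (sym (List.map-∘ Cs)) (List.map-id Cs)

  χᵇ⇒partition : ∀ {N} {Y : Vec G N → Set} {z} → ChiB 𝓜 Y z →
                 ∃ λ Cs → CellPartition Y Cs × z ≡ sumℤ cellWeight Cs
  χᵇ⇒partition (F , P , nonExceptional , z≡) =
    map proj₁ F , IsPartition⇒CellPartition P (All.map⁺ nonExceptional) ,
    trans z≡ (trans (sumℤ-cong (λ c → contrib≡cellWeight (proj₁ c) (proj₂ c)) F)
                    (sym (sumℤ-map cellWeight proj₁ F)))

  topWeight : ∀ {N} → ℕ → Cell 𝓜 N → ℤ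
  topWeight n C = weight (topLayers n C)

  noFull-topLayers : ∀ {N} r (C : Cell 𝓜 N) → ¬ Exceptional 𝓜 C → fullᴸ ∉ topLayers r C
  noFull-topLayers r C ¬exc = nonExceptional⇒noFull C ¬exc ∘ topLayers⊆layers r C

  module _ {m n} (a : Vec G m) {Q : Cell 𝓜 (m + n) → Set} (a∈ : ∀ {C} → Q C → Shadow m n refl ⟦ C ⟧ᶜ a) where

    fibreOf : ∃ Q → Cell 𝓜 n
    fibreOf (C , q) = fibre m n refl C a (a∈ q)

    fibreOf-sem : ∀ c → ⟦ fibreOf c ⟧ᶜ ≐ (λ y → ⟦ proj₁ c ⟧ᶜ (a ++ y))
    fibreOf-sem (C , q) = ≐-trans (fibre-sem m n refl C a (a∈ q))
      (λ y → subst ⟦ C ⟧ᶜ (cast-is-id refl (a ++ y)) , subst ⟦ C ⟧ᶜ (sym (cast-is-id refl (a ++ y))))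

    fibres-partition : ∀ {Y : Vec G (m + n) → Set} (Cs : List (∃ Q)) → CellPartition Y (map proj₁ Cs) →
                       CellPartition (λ y → Y (a ++ y)) (map fibreOf Cs)
    fibres-partition Cs P = record
      { covers         = λ y y∈ →
          Any.map⁺ (Any.map (λ {c} → proj₂ (fibreOf-sem c y)) (Any.map⁻ (covers P (a ++ y) y∈)))
      ; inside         = All.map⁺ (All.map (λ {c} C⊆Y y → C⊆Y _ ∘ proj₁ (fibreOf-sem c y))
                                            (All.map⁻ (inside P)))
      ; disjoint       = AllPairs.map⁺ (AllPairs.map (λ {c} {c′} C#C′ y f f′ →
          C#C′ _ (proj₁ (fibreOf-sem c y) f) (proj₁ (fibreOf-sem c′ y) f′)) (AllPairs.map⁻ (disjoint P)))
      ; nonExceptional = All.map⁺ (All.map (λ {c} ¬exc → noFull⇒nonExceptional (fibreOf c)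
          (noFull-topLayers n (proj₁ c) ¬exc ∘ subst (fullᴸ ∈_) (layers-fibre m n refl (proj₁ c) a _)))
          (All.map⁻ (nonExceptional P)))
      }

    sum-fibres : ∀ (Cs : List (∃ Q)) → sumℤ cellWeight (map fibreOf Cs) ≡ sumℤ (topWeight n ∘ proj₁) Cs
    sum-fibres Cs = trans (sumℤ-map cellWeight fibreOf Cs)
                          (sumℤ-cong (λ c → cong weight (layers-fibre m n refl (proj₁ c) a _)) Cs)

  module _ {m n} {A′ : Vec G m → Set} {Q : Cell 𝓜 (m + n) → Set}
           (A′⊆ : ∀ {C} → Q C → A′ ⊆ Shadow m n refl ⟦ C ⟧ᶜ) where

    restrictionOf : (∃ λ B → ⟦ B ⟧ᶜ ⊆ A′) → ∃ Q → Cell 𝓜 (m + n)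
    restrictionOf (B , B⊆A′) (C , q) = restrict m n refl B C (λ x → A′⊆ q x ∘ B⊆A′ x)

    restrictionOf-sem : ∀ b c → ⟦ restrictionOf b c ⟧ᶜ ≐ (λ w → ⟦ proj₁ c ⟧ᶜ w × ⟦ proj₁ b ⟧ᶜ (take m w))
    restrictionOf-sem (B , B⊆A′) (C , q) = ≐-trans (restrict-sem m n refl B C _)
      (λ w → Product.map₂ (subst ⟦ B ⟧ᶜ (cong (take m) (cast-is-id refl w))) ,
             Product.map₂ (subst ⟦ B ⟧ᶜ (cong (take m) (sym (cast-is-id refl w)))))

    restrictions-partition : ∀ {Y : Vec G (m + n) → Set} (Bs : List (∃ λ B → ⟦ B ⟧ᶜ ⊆ A′)) (Cs : List (∃ Q)) →
      CellPartition A′ (map proj₁ Bs) → CellPartition Y (map proj₁ Cs) → (∀ v → Y v → A′ (take m v)) →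
      CellPartition Y (cartesianProductWith restrictionOf Bs Cs)
    restrictions-partition Bs Cs PB PC Y⊆A′ = record
      { covers         = λ v y → Any.cartesianProductWith⁺ restrictionOf
          (λ {b} {c} b∋ c∋ → proj₂ (restrictionOf-sem b c v) (c∋ , b∋))
          (Any.map⁻ (covers PB (take m v) (Y⊆A′ v y))) (Any.map⁻ (covers PC v y))
      ; inside         = All.cartesianProductWith⁺ (setoid _) (setoid _) restrictionOf Bs Cs λ {b} {c} _ c∈ w →
          All.lookup (All.map⁻ (inside PC)) c∈ w ∘ in-C b c
      ; disjoint       = AllPairs-cartesianProductWith⁺ restrictionOf
          (AllPairs.map (λ {b} {b′} B#B′ c c′ w r r′ → B#B′ _ (in-B b c r) (in-B b′ c′ r′))
                        (AllPairs.map⁻ (disjoint PB)))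
          (AllPairs.map (λ {c} {c′} C#C′ b w r r′ → C#C′ w (in-C b c r) (in-C b c′ r′))
                        (AllPairs.map⁻ (disjoint PC)))
      ; nonExceptional = All.cartesianProductWith⁺ (setoid _) (setoid _) restrictionOf Bs Cs λ {b} {c} b∈ c∈ →
          noFull⇒nonExceptional (restrictionOf b c) λ full∈ →
            [ noFull-topLayers n (proj₁ c) (All.lookup (All.map⁻ (nonExceptional PC)) c∈)
            , nonExceptional⇒noFull (proj₁ b) (All.lookup (All.map⁻ (nonExceptional PB)) b∈) ]′
            (∈-++⁻ (topLayers n (proj₁ c))
                   (subst (fullᴸ ∈_) (layers-restrict m n refl (proj₁ b) (proj₁ c) _) full∈))
      }
      where
      in-C : ∀ b c {w} → ⟦ restrictionOf b c ⟧ᶜ w → ⟦ proj₁ c ⟧ᶜ w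
      in-C b c {w} = proj₁ ∘ proj₁ (restrictionOf-sem b c w)
      in-B : ∀ b c {w} → ⟦ restrictionOf b c ⟧ᶜ w → ⟦ proj₁ b ⟧ᶜ (take m w)
      in-B b c {w} = proj₂ ∘ proj₁ (restrictionOf-sem b c w)

    sum-restrictions : ∀ (Bs : List (∃ λ B → ⟦ B ⟧ᶜ ⊆ A′)) (Cs : List (∃ Q)) →
      sumℤ cellWeight (cartesianProductWith restrictionOf Bs Cs) ≡
      sumℤ (cellWeight ∘ proj₁) Bs * sumℤ (topWeight n ∘ proj₁) Cs
    sum-restrictions =
      sumℤ-cartesianProductWith restrictionOf cellWeight (cellWeight ∘ proj₁) (topWeight n ∘ proj₁)
        λ (B , _) (C , _) → trans
          (cong weight (layers-restrict m n refl B C _))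
          (trans (weight-++ (topLayers n C) (layers B)) (ℤ.*-comm (topWeight n C) (cellWeight B)))

  -- Cells of a decomposition lying above a cell of its projection

  IsDecomp⇒disjoint : ∀ {N} {D : List (Cell 𝓜 N)} → IsDecomp 𝓜 N D → AllPairs Disjoint D
  IsDecomp⇒disjoint {zero}  P       = IsPartition⇒disjoint P
  IsDecomp⇒disjoint {suc N} (P , _) = IsPartition⇒disjoint P

  decomposition-shadows : ∀ {N} {D : List (Cell 𝓜 N)} → IsDecomp 𝓜 N D → ∀ j r (e : j + r ≡ N) {C C′} →
    C ∈ D → C′ ∈ D → ∀ x → Shadow j r e ⟦ C ⟧ᶜ x → Shadow j r e ⟦ C′ ⟧ᶜ x →
    Shadow j r e ⟦ C ⟧ᶜ ≐ Shadow j r e ⟦ C′ ⟧ᶜ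
  decomposition-shadows D-decomp j zero e {C} {C′} C∈ C′∈ x x∈πC x∈πC′
    with ∈-AllPairs₂ (IsDecomp⇒disjoint D-decomp) C∈ C′∈
  ... | inj₁ refl        = ≐-refl
  ... | inj₂ (inj₁ C#C′) = ⊥-elim (C#C′ _ (unshadow C x∈πC) (unshadow C′ x∈πC′))
    where unshadow = λ K → proj₁ (Shadow-zero j e (trans (sym (+-identityʳ j)) e) ⟦ K ⟧ᶜ x)
  ... | inj₂ (inj₂ C′#C) = ⊥-elim (C′#C _ (unshadow C′ x∈πC′) (unshadow C x∈πC))
    where unshadow = λ K → proj₁ (Shadow-zero j e (trans (sym (+-identityʳ j)) e) ⟦ K ⟧ᶜ x)
  decomposition-shadows {zero}  _ j (suc r) e = ⊥-elim (+-suc≢0 e)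
  decomposition-shadows {suc N} (_ , E , E-decomp , base∈E , _) j (suc r) e {C} {C′} C∈ C′∈ x x∈πC x∈πC′ =
    let A  , A∈  , A≐  = base∈E C C∈
        A′ , A′∈ , A′≐ = base∈E C′ C′∈
    in  ≐-trans (lower C A≐)
          (≐-trans (decomposition-shadows E-decomp j r (peel≡ e) A∈ A′∈ x
                                          (proj₁ (lower C A≐ x) x∈πC) (proj₁ (lower C′ A′≐ x) x∈πC′))
                   (≐-sym (lower C′ A′≐)))
    where
    lower : ∀ K {A} → ⟦ A ⟧ᶜ ≐ (λ x → ∃ λ t → ⟦ K ⟧ᶜ (x ∷ʳ t)) →
            Shadow j (suc r) e ⟦ K ⟧ᶜ ≐ Shadow j r (peel≡ e) ⟦ A ⟧ᶜ
    lower K A≐ = ≐-trans (Shadow-suc j r e ⟦ K ⟧ᶜ) (Shadow-cong j r (peel≡ e) (≐-sym A≐))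

  module CellsAbove {m n} {X : Vec G (m + n) → Set} (X-def : Def (m + n) X)
    {D : List (Cell 𝓜 (m + n))} (D-decomp : IsDecomp 𝓜 (m + n) D)
    (X-covered : ∀ v → X v → ∃ λ C → C ∈ D × ⟦ C ⟧ᶜ v × (⟦ C ⟧ᶜ ⊆ X))
    (D-nonExceptional : ∀ C → C ∈ D → ¬ Exceptional 𝓜 C)
    (A : Cell 𝓜 m) {C₀ : Cell 𝓜 (m + n)} (C₀∈D : C₀ ∈ D) (A≐πC₀ : ⟦ A ⟧ᶜ ≐ proj 𝓜 m {n} ⟦ C₀ ⟧ᶜ) where

    π : Cell 𝓜 (m + n) → Vec G m → Set
    π C = Shadow m n refl ⟦ C ⟧ᶜ

    π-take : ∀ C {v} → ⟦ C ⟧ᶜ v → π C (take m v)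
    π-take C {v} c = drop m v , subst ⟦ C ⟧ᶜ (sym (trans (cast-is-id refl _) (take++drop≡id m v))) c

    in-X : ∀ {C} → C ∈ D → X (sample C) → ⟦ C ⟧ᶜ ⊆ X
    in-X {C} C∈D x with X-covered (sample C) x
    ... | C′ , C′∈D , c′ , C′⊆X with ∈-AllPairs₂ (IsDecomp⇒disjoint D-decomp) C∈D C′∈D
    ...   | inj₁ refl        = C′⊆X
    ...   | inj₂ (inj₁ C#C′) = ⊥-elim (C#C′ _ (sample∈ C) c′)
    ...   | inj₂ (inj₂ C′#C) = ⊥-elim (C′#C _ c′ (sample∈ C))

    over-A : ∀ {C} → C ∈ D → ∀ a → π C a → ⟦ A ⟧ᶜ a → π C ≐ ⟦ A ⟧ᶜ
    over-A C∈D a a∈πC a∈A =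
      ≐-trans (decomposition-shadows D-decomp m n refl C∈D C₀∈D a a∈πC (proj₁ (A≐πC₀′ a) a∈A)) (≐-sym A≐πC₀′)
      where A≐πC₀′ = ≐-trans A≐πC₀ (proj≐Shadow m n refl ⟦ C₀ ⟧ᶜ)

    -- By in-X and over-A, a cell of D lies in X above A as soon as its sample point
    -- lies in X and its shadow contains the sample point of A.
    Above : Cell 𝓜 (m + n) → Set
    Above C = X (sample C) × π C (sample A)

    above? : ∀ C → Dec (Above C)
    above? C = definable? (m + n) X-def (sample C) ×-dec
      map′ (proj₁ (πC≐ _)) (proj₂ (πC≐ _)) (cell? (shadowCell m n refl C) _)
      where πC≐ = shadowCell-sem m n refl C

    above : List (Cell 𝓜 (m + n))
    above = filter above? D

    above-partition : CellPartition (λ v → X v × ⟦ A ⟧ᶜ (take m v)) above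
    above-partition = record
      { covers         = λ v (x , a) →
          let C , C∈D , c , C⊆X = X-covered v x
              A⊆πC = proj₂ (over-A C∈D _ (π-take C c) a _)
          in  lose (∈-filter⁺ above? C∈D (C⊆X _ (sample∈ C) , A⊆πC (sample∈ A))) c
      ; inside         = All.tabulate λ C∈ v c →
          let C∈D , x , a₀∈πC = ∈-filter⁻ above? C∈
          in  in-X C∈D x v c , proj₁ (over-A C∈D _ a₀∈πC (sample∈ A) (take m v)) (π-take _ c)
      ; disjoint       = AllPairs.filter⁺ above? (IsDecomp⇒disjoint D-decomp)
      ; nonExceptional = All.filter⁺ above? (All.tabulate (D-nonExceptional _))
      }

    above-over-A : All (λ C → π C ≐ ⟦ A ⟧ᶜ) above
    above-over-A = All.tabulate λ C∈ →
      let C∈D , _ , a₀∈πC = ∈-filter⁻ above? C∈ in over-A C∈D _ a₀∈πC (sample∈ A)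

    cells : List (∃ λ C → π C ≐ ⟦ A ⟧ᶜ)
    cells = All.toList above-over-A

    cells-partition : CellPartition (λ v → X v × ⟦ A ⟧ᶜ (take m v)) (map proj₁ cells)
    cells-partition = subst (CellPartition _) (sym (map-proj₁-toList above-over-A)) above-partition

    e : ℤ
    e = sumℤ (topWeight n ∘ proj₁) cells

    χᵇ-fibre : ∀ a → ⟦ A ⟧ᶜ a → ChiB 𝓜 (λ y → X (a ++ y)) e
    χᵇ-fibre a a∈A = subst (ChiB 𝓜 _) (sum-fibres a a∈πC cells) (χᵇ-partition
      (CellPartition-≐ (λ y → proj₁ , λ x → x , subst ⟦ A ⟧ᶜ (sym (take-++ a y)) a∈A)
                       (fibres-partition a a∈πC cells cells-partition)))
      where
      a∈πC : ∀ {C} → π C ≐ ⟦ A ⟧ᶜ → π C a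
      a∈πC πC≐A = proj₂ (πC≐A a) a∈A

    χᵇ-over-A : ∀ z → ChiB 𝓜 ⟦ A ⟧ᶜ z → ChiB 𝓜 (λ v → X v × ⟦ A ⟧ᶜ (take m v)) (z * e)
    χᵇ-over-A z χᵇA with χᵇ⇒partition χᵇA
    ... | Bs , B-partition , z≡ = subst (ChiB 𝓜 _) sum≡ (χᵇ-partition
      (restrictions-partition A⊆πC pieces cells pieces-partition cells-partition (λ v → proj₂)))
      where
      A⊆πC : ∀ {C} → π C ≐ ⟦ A ⟧ᶜ → ⟦ A ⟧ᶜ ⊆ π C
      A⊆πC πC≐A x = proj₂ (πC≐A x)
      pieces = All.toList (inside B-partition)
      pieces-partition = subst (CellPartition ⟦ A ⟧ᶜ) (sym (map-proj₁-toList (inside B-partition))) B-partition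
      sum≡ : sumℤ cellWeight (cartesianProductWith (restrictionOf A⊆πC) pieces cells) ≡ z * e
      sum≡ = begin
        sumℤ cellWeight (cartesianProductWith (restrictionOf A⊆πC) pieces cells)
          ≡⟨ sum-restrictions A⊆πC pieces cells ⟩
        sumℤ (cellWeight ∘ proj₁) pieces * e
          ≡⟨ cong (_* e) (sumℤ-map cellWeight proj₁ pieces) ⟨
        sumℤ cellWeight (map proj₁ pieces) * e
          ≡⟨ cong (λ Cs → sumℤ cellWeight Cs * e) (map-proj₁-toList (inside B-partition)) ⟩
        sumℤ cellWeight Bs * e
          ≡⟨ cong (_* e) z≡ ⟨
        z * e ∎
        where open ≡-Reasoning

proposition17 : (𝓜 : OMinExpansion) → let open OMinExpansion 𝓜 in
  (m n : ℕ) (X : Vec G (m + n) → Set) → Def (m + n) X →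
  (D : List (Cell 𝓜 (m + n))) → IsDecomp 𝓜 (m + n) D →
  (∀ v → X v → ∃ λ C → C ∈ D × ⟦ 𝓜 ⟧ C v × (⟦ 𝓜 ⟧ C ⊆ X)) →
  (∀ C → C ∈ D → ¬ Exceptional 𝓜 C) →
  (A : Cell 𝓜 m) → (∃ λ C → C ∈ D × (⟦ 𝓜 ⟧ A ≐ proj 𝓜 m {n} (⟦ 𝓜 ⟧ C))) →
  ∃ λ (e : ℤ) →
    (∀ a → ⟦ 𝓜 ⟧ A a → ChiB 𝓜 (λ y → X (a ++ y)) e) ×
    (∀ z → ChiB 𝓜 (⟦ 𝓜 ⟧ A) z →
           ChiB 𝓜 (λ v → X v × ⟦ 𝓜 ⟧ A (take m v)) (z * e))
proposition17 𝓜 m n X X-def D D-decomp X-covered D-nonExceptional A (C₀ , C₀∈D , A≐πC₀) =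
  e , χᵇ-fibre , χᵇ-over-A
  where open CellsAbove 𝓜 X-def D-decomp X-covered D-nonExceptional A C₀∈D A≐πC₀
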